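{- Let $f,g$ be multiplicative functions on $W_{\infty\infty}$ (with complex values), and let $F(x,y)=\sum_{i,j\ge0}f_{ij}x^iy^j$, $G(x,y)=\sum_{i,j\ge0}g_{ij}x^iy^j$, $(F*G)(x,y)=\sum_{i,j\ge0}(f*g)_{ij}x^iy^j$ in $\mathbb C[[x,y]]$. Let $F_0=F(x,0)$, $G_0=G(0,y)$, $\tilde F(x,y)=F(x,G_0\,y)$ and $\tilde G(x,y)=G(F_0\,x,y)$. Then $$\frac1{F*G}=\frac1{\tilde F\,G_0}+\frac1{F_0\,\tilde G}-\frac1{F_0\,G_0}.$$
   Context: Let $\mathcal A_\infty=\{a_1,a_2,\dots\}$ and $\mathcal X_\infty=\{x_1,x_2,\dots\}$ be disjoint alphabets. $W_{\infty\infty}$ is the set of finite shuffle words: words with distinct letters from $\mathcal A_\infty\cup\mathcal X_\infty$ in which the letters from $\mathcal A_\infty$ appear in increasing order of subscripts and likewise those from $\mathcal X_\infty$; it is ordered by the reflexive-transitive closure of $w\lessdot w'$ iff $w'$ is obtained from $w$ by deleting one letter of $\mathcal A_\infty$ or inserting one letter of $\mathcal X_\infty$. For finite alphabets of sizes $i,j$ the analogous poset is denoted $W_{ij}$. Canonical isomorphism type: for $u\le w$ with $u=u_1\cdots u_r$, $w=w_1\cdots w_s$, let $u_{i_1}\cdots u_{i_t}=w_{j_1}\cdots w_{j_t}$ be the common letters, $i_0=j_0=0$, $i_{t+1}=r+1$, $j_{t+1}=s+1$; then $[u,w]\cong\prod_{p=1}^{t+1}W_{i_p-i_{p-1}-1,\,j_p-j_{p-1}-1}$,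 written $[u,w]\simeq_c\prod_{i,j}W_{ij}^{c_{ij}}$ with $c_{ij}$ the number of $p$ giving the pair $(i,j)$. A multiplicative function is a function $f$ on the intervals of $W_{\infty\infty}$ together with numbers $f_{ij}$ ($i,j\ge0$), $f_{00}=1$, such that $f(u,w)=\prod_{i,j}f_{ij}^{c_{ij}}$ whenever $[u,w]\simeq_c\prod W_{ij}^{c_{ij}}$; thus $f_{ij}$ is the value of $f$ on any interval canonically isomorphic to $W_{ij}$. The convolution is $(f*g)(u,w)=\sum_{u\le v\le w}f(u,v)g(v,w)$, and $(f*g)_{ij}$ denotes its value on an interval canonically isomorphic to $W_{ij}$ (e.g. $[a_1\cdots a_i,\,x_1\cdots x_j]$). -}

module Defs where

open import Level using (Level; _⊔_)
open import Data.Nat as ℕ using (ℕ; zero; suc; _∸_; _<_)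
open import Data.List using (List; []; _∷_; _++_; map; zipWith; foldr; upTo; filter)
open import Data.List.Relation.Unary.Linked using (Linked)
open import Data.List.Relation.Unary.Unique.Propositional using (Unique)
open import Data.Product using (_×_; Σ; _,_; ∃)
open import Relation.Nullary using (Dec; yes; no)
open import Relation.Binary.PropositionalEquality using (_≡_; refl; cong)
open import Relation.Binary.Construct.Closure.ReflexiveTransitive using (Star)
open import Algebra.Bundles using (CommutativeRing)
import Data.List.Membership.DecPropositional as DecMem
open import Data.List.Membership.Propositional using (_∈_)

-- a n stands for a_n, x n for x_n (subscripts n ≥ 1 in the paper;
-- we allow any ℕ, words used in the statement only use n ≥ 1).
data Letter : Set where
  a : ℕ → Letter
  x : ℕ → Letter

_≟L_ : (l m : Letter) → Dec (l ≡ m)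
a n ≟L a m with n ℕ.≟ m
... | yes refl = yes refl
... | no n≢m = no λ { refl → n≢m refl }
a n ≟L x m = no λ ()
x n ≟L a m = no λ ()
x n ≟L x m with n ℕ.≟ m
... | yes refl = yes refl
... | no n≢m = no λ { refl → n≢m refl }

open DecMem _≟L_ using (_∈?_)

Word : Set
Word = List Letter

aIdx : Word → List ℕ
aIdx [] = []
aIdx (a n ∷ w) = n ∷ aIdx w
aIdx (x n ∷ w) = aIdx w

xIdx : Word → List ℕ
xIdx [] = []
xIdx (a n ∷ w) = xIdx w
xIdx (x n ∷ w) = n ∷ xIdx w

IsShuffle : Word → Set
IsShuffle w = Unique w × Linked _<_ (aIdx w) × Linked _<_ (xIdx w)

data _⋖_ : Word → Word → Set where
  delA : ∀ p s n → IsShuffle (p ++ a n ∷ s) → IsShuffle (p ++ s) →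
         (p ++ a n ∷ s) ⋖ (p ++ s)
  insX : ∀ p s n → IsShuffle (p ++ s) → IsShuffle (p ++ x n ∷ s) →
         (p ++ s) ⋖ (p ++ x n ∷ s)

_≤W_ : Word → Word → Set
u ≤W w = IsShuffle u × Star _⋖_ u w

-- segs u w : lengths of the maximal segments of u separated by the
-- letters of u that also occur in w (t common letters give t+1 numbers:
-- i_p - i_{p-1} - 1 for p = 1..t+1).
segs : Word → Word → List ℕ
segs [] w = 0 ∷ []
segs (l ∷ u) w with l ∈? w | segs u w
... | yes _ | r = 0 ∷ r
... | no _ | [] = 1 ∷ []
... | no _ | k ∷ r = suc k ∷ r

module _ {c ℓ : Level} (R : CommutativeRing c ℓ) where
  open CommutativeRing R

  canonicalValue : (ℕ → ℕ → Carrier) → Word → Word → Carrier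
  canonicalValue coef u w = foldr _*_ 1# (zipWith coef (segs u w) (segs w u))

  record MultFun : Set (c ⊔ ℓ) where
    field
      fun   : Word → Word → Carrier
      coef  : ℕ → ℕ → Carrier
      coef00 : coef 0 0 ≈ 1#
      mult  : ∀ u w → u ≤W w → fun u w ≈ canonicalValue coef u w
  open MultFun public

  record IntervalEnum (u w : Word) : Set where
    field
      elems    : List Word
      unique   : Unique elems
      complete : ∀ v → u ≤W v → v ≤W w → v ∈ elems
      sound    : ∀ v → v ∈ elems → u ≤W v × v ≤W w
  open IntervalEnum public

  sumList : List Carrier → Carrier
  sumList = foldr _+_ 0#

  convolution : MultFun → MultFun → (u w : Word) → IntervalEnum u w → Carrier
  convolution f g u w E = sumList (map (λ v → fun f u v * fun g v w) (elems E))

  -- formal power series in x, y: S i j = coefficient of x^i y^j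

  Series : Set c
  Series = ℕ → ℕ → Carrier

  _≈S_ : Series → Series → Set ℓ
  A ≈S B = ∀ i j → A i j ≈ B i j

  sumTo : ℕ → (ℕ → Carrier) → Carrier
  sumTo zero h = h 0
  sumTo (suc n) h = sumTo n h + h (suc n)

  addS : Series → Series → Series
  addS A B i j = A i j + B i j

  subS : Series → Series → Series
  subS A B i j = A i j - B i j

  mulS : Series → Series → Series
  mulS A B i j = sumTo i λ k → sumTo j λ l → A k l * B (i ∸ k) (j ∸ l)

  oneS : Series
  oneS zero zero = 1#
  oneS _ _ = 0#

  X : Series
  X 1 0 = 1#
  X _ _ = 0#

  Y : Series
  Y 0 1 = 1#
  Y _ _ = 0#

  powS : Series → ℕ → Series
  powS A zero = oneS
  powS A (suc n) = mulS A (powS A n)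

  -- F(P,Q) for series P, Q with zero constant term (then P^k Q^l only
  -- contributes to degrees ≥ k + l, so the sum below is exact)
  compose : Series → Series → Series → Series
  compose F P Q i j =
    sumTo (i ℕ.+ j) λ k → sumTo (i ℕ.+ j) λ l → F k l * mulS (powS P k) (powS Q l) i j

  IsInverseOf : Series → Series → Set ℓ
  IsInverseOf B A = mulS A B ≈S oneS

  genFun : MultFun → Series
  genFun f = coef f

  atY0 : Series → Series
  atY0 F i zero = F i 0
  atY0 F i (suc _) = 0#

  atX0 : Series → Series
  atX0 G zero j = G 0 j
  atX0 G (suc _) j = 0#

aWord : ℕ → Word
aWord i = map (λ n → a (suc n)) (upTo i)

xWord : ℕ → Word
xWord j = map (λ n → x (suc n)) (upTo j)

module _ {c ℓ : Level} (R : CommutativeRing c ℓ) where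
  convSeries : (f g : MultFun R) → (E : ∀ i j → IntervalEnum R (aWord i) (xWord j)) → Series R
  convSeries f g E i j = convolution R f g (aWord i) (xWord j) (E i j)

-- Split the sum defining (f*g)(a₁⋯a_I, x₁⋯x_J) by the first letter of the middle word v.  This
-- recursion closes once one also tracks the sums conv I J p q whose leading factors are shifted
-- to f_{i,j+p} and g_{i+q,j}; with F_p = Σ f_{ip} xⁱ and G_q = Σ g_{qj} yʲ their generating
-- functions satisfy  Φ p q = F_p G_q + x F_p Φ 0 (q+1) + y G_q Φ (p+1) 0.
-- Along p = 0 and along q = 0 this is a contracting recursion, with unique solutions
-- Φ 0 q = Γ_q K and Φ p 0 = Δ_p L, where K = F₀ + y Φ 1 0, L = G₀ + x Φ 0 1,
-- Γ_q = Σ g_{q+k,l} (F₀x)ᵏ yˡ and Δ_p = Σ f_{l,p+k} (G₀y)ᵏ xˡ.  Thus F*G = Φ 0 0 = G̃ K, and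
-- since F̃ = F₀ + G₀y Δ₁ and G̃ = G₀ + F₀x Γ₁, the relations G₀K = F₀G₀ + G₀yΔ₁ L and
-- F₀L = F₀G₀ + F₀xΓ₁ K eliminate K and L:  (F*G)(F₀G̃ + F̃G₀ − F̃G̃) = F₀G₀F̃G̃,
-- which is the asserted identity between reciprocals.

module Submission where

open import Defs
open import Level using (Level)
open import Algebra.Bundles using (CommutativeRing; Semiring)
open import Data.Nat as ℕ using (ℕ; zero; suc; _∸_; _≤_; _<_; z≤n; s≤s)
import Data.Nat.Properties as ℕₚ
open import Data.Product using (_,_; _×_; proj₁; proj₂)
open import Data.Sum using (_⊎_; inj₁; inj₂)
open import Data.Empty using (⊥-elim)
open import Function using (_∘_)
open import Function.Bundles using (mk⇔)
open import Relation.Nullary using (¬_; Dec; yes; no)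
open import Relation.Binary.Bundles using (Setoid)
open import Relation.Binary.PropositionalEquality as ≡ using (_≡_; _≢_)
import Relation.Binary.Reasoning.Setoid
open import Relation.Binary.Construct.Closure.ReflexiveTransitive using (Star; ε; _◅_; _◅◅_)
import Algebra.Construct.Pointwise ℕ as Pointwise
open import Data.List using (List; []; _∷_; _++_; map; zipWith; foldr; length; applyUpTo)
import Data.List.Properties as Listₚ
open import Data.List.Membership.Propositional using (_∈_; _∉_)
open import Data.List.Membership.Propositional.Properties using (∈-++⁺ˡ; ∈-++⁺ʳ; ∈-++⁻; ∈-map⁺; ∈-map⁻)
open import Data.List.Membership.Propositional.Properties.WithK using (unique∧set⇒bag)
import Data.List.Membership.DecPropositional as DecMembership
open import Data.List.Relation.Binary.BagAndSetEquality using (∼bag⇒↭)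
open import Data.List.Relation.Unary.Any using (here; there)
open import Data.List.Relation.Unary.All as All using (All; []; _∷_)
import Data.List.Relation.Unary.All.Properties as Allₚ
open import Data.List.Relation.Unary.AllPairs as AllPairs using ([]; _∷_)
open import Data.List.Relation.Unary.Linked as Linked using (Linked; []; [-]; _∷_)
open import Data.List.Relation.Unary.Linked.Properties using (Linked⇒AllPairs; applyUpTo⁺₂)
open import Data.List.Relation.Unary.Unique.Propositional using (Unique)
import Data.List.Relation.Unary.Unique.Propositional.Properties as Uniqueₚ

module FiniteSums {c ℓ : Level} (R : CommutativeRing c ℓ) where

  open CommutativeRing R hiding (zero)
  open import Relation.Binary.Reasoning.Setoid setoid
  open import Algebra.Properties.CommutativeSemigroup +-commutativeSemigroup using (interchange)

  ∑ : ℕ → (ℕ → Carrier) → Carrier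
  ∑ = sumTo R

  ∑-cong≤ : ∀ n {h h′ : ℕ → Carrier} → (∀ k → k ≤ n → h k ≈ h′ k) → ∑ n h ≈ ∑ n h′
  ∑-cong≤ zero    h≈h′ = h≈h′ 0 z≤n
  ∑-cong≤ (suc n) h≈h′ = +-cong (∑-cong≤ n (λ k k≤n → h≈h′ k (ℕₚ.m≤n⇒m≤1+n k≤n))) (h≈h′ (suc n) ℕₚ.≤-refl)

  ∑-cong : ∀ n {h h′ : ℕ → Carrier} → (∀ k → h k ≈ h′ k) → ∑ n h ≈ ∑ n h′
  ∑-cong n h≈h′ = ∑-cong≤ n (λ k _ → h≈h′ k)

  ∑-+ : ∀ n (h h′ : ℕ → Carrier) → ∑ n (λ k → h k + h′ k) ≈ ∑ n h + ∑ n h′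
  ∑-+ zero    h h′ = refl
  ∑-+ (suc n) h h′ = trans (+-congʳ (∑-+ n h h′)) (interchange _ _ _ _)

  *-distribˡ-∑ : ∀ n s (h : ℕ → Carrier) → s * ∑ n h ≈ ∑ n (λ k → s * h k)
  *-distribˡ-∑ zero    s h = refl
  *-distribˡ-∑ (suc n) s h = trans (distribˡ s _ _) (+-congʳ (*-distribˡ-∑ n s h))

  *-distribʳ-∑ : ∀ n s (h : ℕ → Carrier) → ∑ n h * s ≈ ∑ n (λ k → h k * s)
  *-distribʳ-∑ zero    s h = refl
  *-distribʳ-∑ (suc n) s h = trans (distribʳ s _ _) (+-congʳ (*-distribʳ-∑ n s h))

  ∑-zero : ∀ n {h : ℕ → Carrier} → (∀ k → k ≤ n → h k ≈ 0#) → ∑ n h ≈ 0#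
  ∑-zero n h≈0 = trans (∑-cong≤ n h≈0) (zeros n)
    where
    zeros : ∀ n → ∑ n (λ _ → 0#) ≈ 0#
    zeros zero    = refl
    zeros (suc n) = trans (+-identityʳ _) (zeros n)

  ∑-unfoldˡ : ∀ n (h : ℕ → Carrier) → ∑ (suc n) h ≈ h 0 + ∑ n (λ k → h (suc k))
  ∑-unfoldˡ zero    h = refl
  ∑-unfoldˡ (suc n) h = trans (+-congʳ (∑-unfoldˡ n h)) (+-assoc _ _ _)

  ∑-extend : ∀ n m (h : ℕ → Carrier) → n ≤ m → (∀ k → n < k → k ≤ m → h k ≈ 0#) → ∑ m h ≈ ∑ n h
  ∑-extend n zero    h z≤n _ = refl
  ∑-extend n (suc m) h n≤1+m h≈0 with n ℕ.≟ suc m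
  ... | yes ≡.refl = refl
  ... | no  n≢1+m  = trans (+-cong (∑-extend n m h n≤m (λ k n<k k≤m → h≈0 k n<k (ℕₚ.m≤n⇒m≤1+n k≤m)))
                                   (h≈0 (suc m) (s≤s n≤m) ℕₚ.≤-refl))
                           (+-identityʳ _)
    where n≤m = ℕₚ.≤-pred (ℕₚ.≤∧≢⇒< n≤1+m n≢1+m)

  ∑-single : ∀ n m (h : ℕ → Carrier) → m ≤ n → (∀ k → k ≤ n → k ≢ m → h k ≈ 0#) → ∑ n h ≈ h m
  ∑-single n zero    h _ h≈0 = begin
    ∑ n h       ≈⟨ ∑-extend 0 n h z≤n (λ k 0<k k≤n → h≈0 k k≤n (ℕₚ.>⇒≢ 0<k)) ⟩
    h 0         ∎
  ∑-single n (suc m) h m<n h≈0 = begin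
    ∑ n h                  ≈⟨ ∑-extend (suc m) n h m<n (λ k m<k k≤n → h≈0 k k≤n (ℕₚ.>⇒≢ m<k)) ⟩
    ∑ m h + h (suc m)      ≈⟨ +-congʳ (∑-zero m (λ k k≤m → h≈0 k (ℕₚ.≤-trans k≤m (ℕₚ.<⇒≤ m<n))
                                                                  (ℕₚ.<⇒≢ (s≤s k≤m)))) ⟩
    0# + h (suc m)         ≈⟨ +-identityˡ _ ⟩
    h (suc m)              ∎

  ∑-comm : ∀ n m (h : ℕ → ℕ → Carrier) → ∑ n (λ k → ∑ m (h k)) ≈ ∑ m (λ l → ∑ n (λ k → h k l))
  ∑-comm zero    m h = refl
  ∑-comm (suc n) m h = trans (+-congʳ (∑-comm n m h)) (sym (∑-+ m _ _))

  ∑-reverse : ∀ n (h : ℕ → Carrier) → ∑ n h ≈ ∑ n (λ k → h (n ∸ k))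
  ∑-reverse zero    h = refl
  ∑-reverse (suc n) h = begin
    ∑ (suc n) h                                ≈⟨ trans (∑-unfoldˡ n h) (+-comm _ _) ⟩
    ∑ n (λ k → h (suc k)) + h 0                ≈⟨ +-congʳ (∑-reverse n (λ k → h (suc k))) ⟩
    ∑ n (λ k → h (suc (n ∸ k))) + h 0
      ≈⟨ +-cong (∑-cong≤ n (λ k k≤n → reflexive (≡.cong h (≡.sym (ℕₚ.+-∸-assoc 1 k≤n)))))
                (reflexive (≡.cong h (≡.sym (ℕₚ.n∸n≡0 n)))) ⟩
    ∑ (suc n) (λ k → h (suc n ∸ k))            ∎

  ∑-triangle : ∀ n (h : ℕ → ℕ → Carrier) →
    ∑ n (λ k → ∑ k (λ j → h j k)) ≈ ∑ n (λ j → ∑ (n ∸ j) (λ m → h j (j ℕ.+ m)))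
  ∑-triangle zero    h = refl
  ∑-triangle (suc n) h = begin
    ∑ n (λ k → ∑ k (λ j → h j k)) + ∑ (suc n) (λ j → h j (suc n))
      ≈⟨ +-congʳ (∑-triangle n h) ⟩
    ∑ n (λ j → ∑ (n ∸ j) (λ m → h j (j ℕ.+ m))) + (∑ n (λ j → h j (suc n)) + h (suc n) (suc n))
      ≈⟨ sym (+-assoc _ _ _) ⟩
    ∑ n (λ j → ∑ (n ∸ j) (λ m → h j (j ℕ.+ m))) + ∑ n (λ j → h j (suc n)) + h (suc n) (suc n)
      ≈⟨ +-cong (trans (sym (∑-+ n _ _)) (∑-cong≤ n row)) (reflexive (≡.cong (h (suc n)) (≡.sym (ℕₚ.+-identityʳ (suc n))))) ⟩
    ∑ n (λ j → ∑ (suc n ∸ j) (λ m → h j (j ℕ.+ m))) + h (suc n) (suc n ℕ.+ 0)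
      ≈⟨ +-congˡ (reflexive (≡.cong (λ t → ∑ t (λ m → h (suc n) (suc n ℕ.+ m))) (≡.sym (ℕₚ.n∸n≡0 n)))) ⟩
    ∑ (suc n) (λ j → ∑ (suc n ∸ j) (λ m → h j (j ℕ.+ m)))   ∎
    where
    row : ∀ j → j ≤ n → ∑ (n ∸ j) (λ m → h j (j ℕ.+ m)) + h j (suc n) ≈ ∑ (suc n ∸ j) (λ m → h j (j ℕ.+ m))
    row j j≤n = begin
      ∑ (n ∸ j) (λ m → h j (j ℕ.+ m)) + h j (suc n)
        ≈⟨ +-congˡ (reflexive (≡.cong (h j) (≡.sym (≡.trans (ℕₚ.+-suc j (n ∸ j)) (≡.cong suc (ℕₚ.m+[n∸m]≡n j≤n)))))) ⟩
      ∑ (suc (n ∸ j)) (λ m → h j (j ℕ.+ m))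
        ≈⟨ reflexive (≡.cong (λ t → ∑ t (λ m → h j (j ℕ.+ m))) (≡.sym (ℕₚ.+-∸-assoc 1 j≤n))) ⟩
      ∑ (suc n ∸ j) (λ m → h j (j ℕ.+ m))   ∎

module PowerSeries {c ℓ : Level} (R : CommutativeRing c ℓ) where

  open CommutativeRing R hiding (zero)
  open import Relation.Binary.Reasoning.Setoid setoid
  open FiniteSums R

  private
    PS : Set c
    PS = ℕ → Carrier

    _≋_ : PS → PS → Set ℓ
    A ≋ B = ∀ n → A n ≈ B n

    _⊛_ : PS → PS → PS
    (A ⊛ B) n = ∑ n (λ k → A k * B (n ∸ k))

    _⊕_ : PS → PS → PS
    (A ⊕ B) n = A n + B n

    unit : PS
    unit zero    = 1#
    unit (suc n) = 0#

    ⊛-cong : ∀ {A A′ B B′} → A ≋ A′ → B ≋ B′ → (A ⊛ B) ≋ (A′ ⊛ B′)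
    ⊛-cong A≋A′ B≋B′ n = ∑-cong n (λ k → *-cong (A≋A′ k) (B≋B′ (n ∸ k)))

    ⊛-comm : ∀ A B → (A ⊛ B) ≋ (B ⊛ A)
    ⊛-comm A B n = begin
      ∑ n (λ k → A k * B (n ∸ k))                 ≈⟨ ∑-reverse n _ ⟩
      ∑ n (λ k → A (n ∸ k) * B (n ∸ (n ∸ k)))     ≈⟨ ∑-cong≤ n (λ k k≤n → trans (*-comm _ _)
                                                       (*-congʳ (reflexive (≡.cong B (ℕₚ.m∸[m∸n]≡n k≤n))))) ⟩
      ∑ n (λ k → B k * A (n ∸ k))                 ∎

    ⊛-assoc : ∀ A B C → ((A ⊛ B) ⊛ C) ≋ (A ⊛ (B ⊛ C))
    ⊛-assoc A B C n = begin
      ∑ n (λ k → ∑ k (λ j → A j * B (k ∸ j)) * C (n ∸ k))          ≈⟨ ∑-cong n (λ k → *-distribʳ-∑ k _ _) ⟩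
      ∑ n (λ k → ∑ k (λ j → A j * B (k ∸ j) * C (n ∸ k)))          ≈⟨ ∑-triangle n _ ⟩
      ∑ n (λ j → ∑ (n ∸ j) (λ m → A j * B (j ℕ.+ m ∸ j) * C (n ∸ (j ℕ.+ m))))
        ≈⟨ ∑-cong n (λ j → ∑-cong (n ∸ j) (λ m → trans (*-assoc _ _ _)
             (*-congˡ (*-cong (reflexive (≡.cong B (ℕₚ.m+n∸m≡n j m))) (reflexive (≡.cong C (≡.sym (ℕₚ.∸-+-assoc n j m)))))))) ⟩
      ∑ n (λ j → ∑ (n ∸ j) (λ m → A j * (B m * C (n ∸ j ∸ m))))     ≈⟨ ∑-cong n (λ j → sym (*-distribˡ-∑ (n ∸ j) _ _)) ⟩
      ∑ n (λ j → A j * ∑ (n ∸ j) (λ m → B m * C (n ∸ j ∸ m)))       ∎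

    ⊛-identityˡ : ∀ A → (unit ⊛ A) ≋ A
    ⊛-identityˡ A n = trans (∑-single n 0 _ z≤n off-diagonal) (*-identityˡ _)
      where
      off-diagonal : ∀ k → k ≤ n → k ≢ 0 → unit k * A (n ∸ k) ≈ 0#
      off-diagonal zero    _ k≢0 = ⊥-elim (k≢0 ≡.refl)
      off-diagonal (suc k) _ _   = zeroˡ _

    ⊛-distribʳ : ∀ A B C → ((B ⊕ C) ⊛ A) ≋ ((B ⊛ A) ⊕ (C ⊛ A))
    ⊛-distribʳ A B C n = trans (∑-cong n (λ k → distribʳ _ _ _)) (∑-+ n _ _)

    ⊕-cong : ∀ {A A′ B B′} → A ≋ A′ → B ≋ B′ → (A ⊕ B) ≋ (A′ ⊕ B′)
    ⊕-cong A≋A′ B≋B′ n = +-cong (A≋A′ n) (B≋B′ n)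

    ≋-setoid : Setoid c ℓ
    ≋-setoid = record { isEquivalence = Pointwise.isEquivalence isEquivalence }

    open import Algebra.Consequences.Setoid ≋-setoid using (comm∧idˡ⇒id; comm∧distrʳ⇒distr)

  powerSeriesRing : CommutativeRing c ℓ
  powerSeriesRing = record
    { Carrier = PS ; _≈_ = _≋_ ; _+_ = _⊕_ ; _*_ = _⊛_ ; -_ = λ A n → - A n ; 0# = λ _ → 0# ; 1# = unit
    ; isCommutativeRing = record
      { isRing = record
        { +-isAbelianGroup = Pointwise.isAbelianGroup +-isAbelianGroup
        ; *-cong = ⊛-cong
        ; *-assoc = ⊛-assoc
        ; *-identity = comm∧idˡ⇒id ⊛-comm ⊛-identityˡ
        ; distrib = comm∧distrʳ⇒distr ⊕-cong ⊛-comm ⊛-distribʳ }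
      ; *-comm = ⊛-comm } }

  sumTo-coeff : ∀ n (h : ℕ → PS) k → sumTo powerSeriesRing n h k ≈ ∑ n (λ m → h m k)
  sumTo-coeff zero    h k = refl
  sumTo-coeff (suc n) h k = +-congʳ (sumTo-coeff n h k)

module BivariateSeries {c ℓ : Level} (R : CommutativeRing c ℓ) where

  open PowerSeries using (powerSeriesRing; sumTo-coeff)
  import Algebra.Properties.CommutativeSemigroup ℕₚ.+-commutativeSemigroup as ℕ+

  open CommutativeRing R hiding (zero)
  open FiniteSums R
  open import Relation.Binary.Reasoning.Setoid setoid

  -- A bivariate series is a power series in x whose coefficients are power series in y.
  R₂ : CommutativeRing c ℓ
  R₂ = powerSeriesRing (powerSeriesRing R)

  module R₂ = CommutativeRing R₂
  open R₂ public using ()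
    renaming (_≈_ to infix 4 _≈₂_; _+_ to infixl 6 _+₂_; _*_ to infixl 7 _*₂_; 0# to 0₂; 1# to 1₂)
  open import Algebra.Definitions.RawSemiring (Semiring.rawSemiring R₂.semiring) public using (_^_)

  ∑₂ : ℕ → (ℕ → Series R) → Series R
  ∑₂ = sumTo R₂

  ∑₂-coeff : ∀ n (h : ℕ → Series R) i j → ∑₂ n h i j ≈ ∑ n (λ k → h k i j)
  ∑₂-coeff n h i j = trans (sumTo-coeff (powerSeriesRing R) n h i j)
                           (sumTo-coeff R n (λ k → h k i) j)

  mulS≈* : ∀ A B → mulS R A B ≈₂ A *₂ B
  mulS≈* A B i j = sym (sumTo-coeff R i (λ k → A k R₁.* B (i ∸ k)) j)
    where module R₁ = CommutativeRing (powerSeriesRing R)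

  powS≈^ : ∀ A n → powS R A n ≈₂ A ^ n
  powS≈^ A zero    zero    zero    = refl
  powS≈^ A zero    zero    (suc j) = refl
  powS≈^ A zero    (suc i) j       = refl
  powS≈^ A (suc n) = R₂.trans (mulS≈* A (powS R A n)) (R₂.*-congˡ (powS≈^ A n))

  Agree< : ℕ → Series R → Series R → Set ℓ
  Agree< n A B = ∀ i j → i ℕ.+ j < n → A i j ≈ B i j

  VanishesBelow : ℕ → Series R → Set ℓ
  VanishesBelow n A = Agree< n A 0₂

  private
    residual-degree : ∀ {i j k l d n} → k ≤ i → l ≤ j → i ℕ.+ j < d ℕ.+ n → d ≤ k ℕ.+ l →
                      (i ∸ k) ℕ.+ (j ∸ l) < n
    residual-degree {i} {j} {k} {l} {d} {n} k≤i l≤j i+j<d+n d≤k+l with (i ∸ k) ℕ.+ (j ∸ l) ℕ.<? n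
    ... | yes below = below
    ... | no  ≮n    = ⊥-elim (ℕₚ.<⇒≱ i+j<d+n (ℕₚ.≤-trans (ℕₚ.+-mono-≤ d≤k+l (ℕₚ.≮⇒≥ ≮n)) (ℕₚ.≤-reflexive split)))
      where
      split : (k ℕ.+ l) ℕ.+ ((i ∸ k) ℕ.+ (j ∸ l)) ≡ i ℕ.+ j
      split = ≡.trans (ℕ+.interchange k l (i ∸ k) (j ∸ l)) (≡.cong₂ ℕ._+_ (ℕₚ.m+[n∸m]≡n k≤i) (ℕₚ.m+[n∸m]≡n l≤j))

    factor-degrees : ∀ {i j k l} → k ≤ i → l ≤ j → k ℕ.+ l ≤ i ℕ.+ j × (i ∸ k) ℕ.+ (j ∸ l) ≤ i ℕ.+ j
    factor-degrees {i} {j} {k} {l} k≤i l≤j = ℕₚ.+-mono-≤ k≤i l≤j , ℕₚ.+-mono-≤ (ℕₚ.m∸n≤m i k) (ℕₚ.m∸n≤m j l)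

  *-coeff : ∀ A B i j → (A *₂ B) i j ≈ ∑ i (λ k → ∑ j (λ l → A k l * B (i ∸ k) (j ∸ l)))
  *-coeff A B i j = sym (mulS≈* A B i j)

  *-cong-coeff : ∀ {A A′ B B′} i j →
    (∀ k l → k ≤ i → l ≤ j → A k l * B (i ∸ k) (j ∸ l) ≈ A′ k l * B′ (i ∸ k) (j ∸ l)) →
    (A *₂ B) i j ≈ (A′ *₂ B′) i j
  *-cong-coeff {A} {A′} {B} {B′} i j terms = begin
    (A *₂ B) i j                                           ≈⟨ *-coeff A B i j ⟩
    ∑ i (λ k → ∑ j (λ l → A k l * B (i ∸ k) (j ∸ l)))      ≈⟨ ∑-cong≤ i (λ k k≤i → ∑-cong≤ j (λ l l≤j → terms k l k≤i l≤j)) ⟩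
    ∑ i (λ k → ∑ j (λ l → A′ k l * B′ (i ∸ k) (j ∸ l)))    ≈⟨ mulS≈* A′ B′ i j ⟩
    (A′ *₂ B′) i j                                         ∎

  *-agree : ∀ n {A A′ B B′} → Agree< n A A′ → Agree< n B B′ → Agree< n (A *₂ B) (A′ *₂ B′)
  *-agree n {A} {A′} {B} {B′} A≈A′ B≈B′ i j i+j<n = *-cong-coeff {A} {A′} {B} {B′} i j λ k l k≤i l≤j →
    let (k+l≤ , rest≤) = factor-degrees k≤i l≤j
    in *-cong (A≈A′ k l (ℕₚ.≤-<-trans k+l≤ i+j<n)) (B≈B′ (i ∸ k) (j ∸ l) (ℕₚ.≤-<-trans rest≤ i+j<n))

  vanishing-*-agree : ∀ d n {M A B} → VanishesBelow d M → Agree< n A B → Agree< (d ℕ.+ n) (M *₂ A) (M *₂ B)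
  vanishing-*-agree d n {M} {A} {B} M≈0 A≈B i j i+j<d+n = *-cong-coeff {M} {M} {A} {B} i j term
    where
    term : ∀ k l → k ≤ i → l ≤ j → M k l * A (i ∸ k) (j ∸ l) ≈ M k l * B (i ∸ k) (j ∸ l)
    term k l k≤i l≤j with k ℕ.+ l ℕ.<? d
    ... | yes k+l<d = trans (*-congʳ (M≈0 k l k+l<d)) (trans (zeroˡ _) (sym (trans (*-congʳ (M≈0 k l k+l<d)) (zeroˡ _))))
    ... | no  k+l≮d = *-congˡ (A≈B (i ∸ k) (j ∸ l) (residual-degree k≤i l≤j i+j<d+n (ℕₚ.≮⇒≥ k+l≮d)))

  vanishing-* : ∀ d e {A B} → VanishesBelow d A → VanishesBelow e B → VanishesBelow (d ℕ.+ e) (A *₂ B)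
  vanishing-* d e {A} A≈0 B≈0 i j i+j<d+e =
    trans (vanishing-*-agree d e A≈0 B≈0 i j i+j<d+e) (R₂.zeroʳ A i j)

  vanishing-^ : ∀ {A} n → VanishesBelow 1 A → VanishesBelow n (A ^ n)
  vanishing-^ zero    A≈0 i j ()
  vanishing-^ (suc n) A≈0 = vanishing-* 1 n A≈0 (vanishing-^ n A≈0)

  vanishing-cong : ∀ {A B} d → A ≈₂ B → VanishesBelow d A → VanishesBelow d B
  vanishing-cong d A≈B A≈0 i j i+j<d = trans (sym (A≈B i j)) (A≈0 i j i+j<d)

  -- M has no constant term, so each unfolding of the recursion fixes Z q in one more total degree.
  recursion-unique : ∀ (M : Series R) (U Z Z′ : ℕ → Series R) → VanishesBelow 1 M →
    (∀ q → Z q ≈₂ U q +₂ M *₂ Z (suc q)) → (∀ q → Z′ q ≈₂ U q +₂ M *₂ Z′ (suc q)) →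
    ∀ q → Z q ≈₂ Z′ q
  recursion-unique M U Z Z′ M≈0 Z-rec Z′-rec q i j = agree (suc (i ℕ.+ j)) q i j ℕₚ.≤-refl
    where
    agree : ∀ n q → Agree< n (Z q) (Z′ q)
    agree zero    q i j ()
    agree (suc n) q i j i+j<1+n = begin
      Z q i j                          ≈⟨ Z-rec q i j ⟩
      (U q +₂ M *₂ Z (suc q)) i j      ≈⟨ +-congˡ (vanishing-*-agree 1 n M≈0 (agree n (suc q)) i j i+j<1+n) ⟩
      (U q +₂ M *₂ Z′ (suc q)) i j     ≈⟨ sym (Z′-rec q i j) ⟩
      Z′ q i j                         ∎

  recursion-solution : ∀ {M} {V Γ Z : ℕ → Series R} K → VanishesBelow 1 M →
    (∀ q → Γ q ≈₂ V q +₂ M *₂ Γ (suc q)) → (∀ q → Z q ≈₂ V q *₂ K +₂ M *₂ Z (suc q)) →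
    ∀ q → Z q ≈₂ Γ q *₂ K
  recursion-solution {M} {V} {Γ} {Z} K M≈0 Γ-rec Z-rec =
    recursion-unique M (λ q → V q *₂ K) Z (λ q → Γ q *₂ K) M≈0 Z-rec ΓK-rec
    where
    ΓK-rec : ∀ q → Γ q *₂ K ≈₂ V q *₂ K +₂ M *₂ (Γ (suc q) *₂ K)
    ΓK-rec q = R₂.trans (R₂.*-congʳ {K} (Γ-rec q))
                 (R₂.trans (R₂.distribʳ K (V q) (M *₂ Γ (suc q))) (R₂.+-congˡ (R₂.*-assoc M (Γ (suc q)) K)))

  δ : ℕ → ℕ → Carrier
  δ zero    zero    = 1#
  δ zero    (suc n) = 0#
  δ (suc m) zero    = 0#
  δ (suc m) (suc n) = δ m n

  δ-refl : ∀ n → δ n n ≈ 1#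
  δ-refl zero    = refl
  δ-refl (suc n) = δ-refl n

  δ-≢ : ∀ {m n} → n ≢ m → δ m n ≈ 0#
  δ-≢ {zero}  {zero}  n≢m = ⊥-elim (n≢m ≡.refl)
  δ-≢ {zero}  {suc n} _   = refl
  δ-≢ {suc m} {zero}  _   = refl
  δ-≢ {suc m} {suc n} n≢m = δ-≢ (λ n≡m → n≢m (≡.cong suc n≡m))

  monomial : Carrier → ℕ → ℕ → Series R
  monomial s m n i j = s * (δ m i * δ n j)

  monomial-off : ∀ s m n i j → i ≢ m ⊎ j ≢ n → monomial s m n i j ≈ 0#
  monomial-off s m n i j (inj₁ i≢m) = trans (*-congˡ (trans (*-congʳ (δ-≢ i≢m)) (zeroˡ _))) (zeroʳ _)
  monomial-off s m n i j (inj₂ j≢n) = trans (*-congˡ (trans (*-congˡ (δ-≢ j≢n)) (zeroʳ _))) (zeroʳ _)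

  monomial-on : ∀ s m n → monomial s m n m n ≈ s
  monomial-on s m n = trans (*-congˡ (trans (*-cong (δ-refl m) (δ-refl n)) (*-identityˡ 1#))) (*-identityʳ s)

  monomial-*-inside : ∀ s m n A i j → m ≤ i → n ≤ j → (monomial s m n *₂ A) i j ≈ s * A (i ∸ m) (j ∸ n)
  monomial-*-inside s m n A i j m≤i n≤j = begin
    (monomial s m n *₂ A) i j
      ≈⟨ *-coeff (monomial s m n) A i j ⟩
    ∑ i (λ k → ∑ j (λ l → monomial s m n k l * A (i ∸ k) (j ∸ l)))
      ≈⟨ ∑-single i m _ m≤i (λ k _ k≢m → ∑-zero j (λ l _ → trans (*-congʳ (monomial-off s m n k l (inj₁ k≢m))) (zeroˡ _))) ⟩
    ∑ j (λ l → monomial s m n m l * A (i ∸ m) (j ∸ l))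
      ≈⟨ ∑-single j n _ n≤j (λ l _ l≢n → trans (*-congʳ (monomial-off s m n m l (inj₂ l≢n))) (zeroˡ _)) ⟩
    monomial s m n m n * A (i ∸ m) (j ∸ n)
      ≈⟨ *-congʳ (monomial-on s m n) ⟩
    s * A (i ∸ m) (j ∸ n)   ∎

  monomial-*-outside : ∀ s m n A i j → i < m ⊎ j < n → (monomial s m n *₂ A) i j ≈ 0#
  monomial-*-outside s m n A i j outside = trans (*-coeff (monomial s m n) A i j)
    (∑-zero i (λ k k≤i → ∑-zero j (λ l l≤j → trans (*-congʳ (monomial-off s m n k l (off k≤i l≤j outside))) (zeroˡ _))))
    where
    off : ∀ {k l} → k ≤ i → l ≤ j → i < m ⊎ j < n → k ≢ m ⊎ l ≢ n
    off k≤i _ (inj₁ i<m) = inj₁ (λ { ≡.refl → ℕₚ.<⇒≱ i<m k≤i })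
    off _ l≤j (inj₂ j<n) = inj₂ (λ { ≡.refl → ℕₚ.<⇒≱ j<n l≤j })

  δ-shift : ∀ m m′ {i} → m ≤ i → δ m′ (i ∸ m) ≡ δ (m ℕ.+ m′) i
  δ-shift zero    m′ _         = ≡.refl
  δ-shift (suc m) m′ (s≤s m≤i) = δ-shift m m′ m≤i

  monomial-*-monomial : ∀ m n m′ n′ → monomial 1# m n *₂ monomial 1# m′ n′ ≈₂ monomial 1# (m ℕ.+ m′) (n ℕ.+ n′)
  monomial-*-monomial m n m′ n′ i j with m ℕ.≤? i | n ℕ.≤? j
  ... | yes m≤i | yes n≤j = trans (monomial-*-inside 1# m n (monomial 1# m′ n′) i j m≤i n≤j)
                                  (trans (*-identityˡ _) (reflexive (≡.cong (1# *_) (≡.cong₂ _*_ (δ-shift m m′ m≤i) (δ-shift n n′ n≤j)))))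
  ... | no m≰i | _ = trans (monomial-*-outside 1# m n (monomial 1# m′ n′) i j (inj₁ i<m))
                           (sym (monomial-off 1# (m ℕ.+ m′) (n ℕ.+ n′) i j (inj₁ (ℕₚ.<⇒≢ (ℕₚ.<-≤-trans i<m (ℕₚ.m≤m+n m m′))))))
    where i<m = ℕₚ.≰⇒> m≰i
  ... | _ | no n≰j = trans (monomial-*-outside 1# m n (monomial 1# m′ n′) i j (inj₂ j<n))
                           (sym (monomial-off 1# (m ℕ.+ m′) (n ℕ.+ n′) i j (inj₂ (ℕₚ.<⇒≢ (ℕₚ.<-≤-trans j<n (ℕₚ.m≤m+n n n′))))))
    where j<n = ℕₚ.≰⇒> n≰j

  X≈monomial : X R ≈₂ monomial 1# 1 0
  X≈monomial zero          j       = sym (monomial-off 1# 1 0 0 j (inj₁ (λ ())))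
  X≈monomial (suc zero)    zero    = sym (monomial-on 1# 1 0)
  X≈monomial (suc zero)    (suc j) = sym (monomial-off 1# 1 0 1 (suc j) (inj₂ (λ ())))
  X≈monomial (suc (suc i)) j       = sym (monomial-off 1# 1 0 (suc (suc i)) j (inj₁ (λ ())))

  Y≈monomial : Y R ≈₂ monomial 1# 0 1
  Y≈monomial (suc i) j             = sym (monomial-off 1# 0 1 (suc i) j (inj₁ (λ ())))
  Y≈monomial zero    zero          = sym (monomial-off 1# 0 1 0 0 (inj₂ (λ ())))
  Y≈monomial zero    (suc zero)    = sym (monomial-on 1# 0 1)
  Y≈monomial zero    (suc (suc j)) = sym (monomial-off 1# 0 1 0 (suc (suc j)) (inj₂ (λ ())))

  1≈monomial : 1₂ ≈₂ monomial 1# 0 0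
  1≈monomial zero    zero    = sym (monomial-on 1# 0 0)
  1≈monomial zero    (suc j) = sym (monomial-off 1# 0 0 0 (suc j) (inj₂ (λ ())))
  1≈monomial (suc i) j       = sym (monomial-off 1# 0 0 (suc i) j (inj₁ (λ ())))

  X^≈monomial : ∀ k → X R ^ k ≈₂ monomial 1# k 0
  X^≈monomial zero    = 1≈monomial
  X^≈monomial (suc k) = R₂.trans (R₂.*-cong X≈monomial (X^≈monomial k)) (monomial-*-monomial 1 0 k 0)

  Y^≈monomial : ∀ k → Y R ^ k ≈₂ monomial 1# 0 k
  Y^≈monomial zero    = 1≈monomial
  Y^≈monomial (suc k) = R₂.trans (R₂.*-cong Y≈monomial (Y^≈monomial k)) (monomial-*-monomial 0 1 0 k)

  X-*-suc : ∀ A i j → (X R *₂ A) (suc i) j ≈ A i j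
  X-*-suc A i j = trans (R₂.*-congʳ {A} X≈monomial (suc i) j) (trans (monomial-*-inside 1# 1 0 A (suc i) j (s≤s z≤n) z≤n) (*-identityˡ _))

  X-*-zero : ∀ A j → (X R *₂ A) 0 j ≈ 0#
  X-*-zero A j = trans (R₂.*-congʳ {A} X≈monomial 0 j) (monomial-*-outside 1# 1 0 A 0 j (inj₁ (s≤s z≤n)))

  Y-*-suc : ∀ A i j → (Y R *₂ A) i (suc j) ≈ A i j
  Y-*-suc A i j = trans (R₂.*-congʳ {A} Y≈monomial i (suc j)) (trans (monomial-*-inside 1# 0 1 A i (suc j) z≤n (s≤s z≤n)) (*-identityˡ _))

  Y-*-zero : ∀ A i → (Y R *₂ A) i 0 ≈ 0#
  Y-*-zero A i = trans (R₂.*-congʳ {A} Y≈monomial i 0) (monomial-*-outside 1# 0 1 A i 0 (inj₂ (s≤s z≤n)))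

  X-vanishing : VanishesBelow 1 (X R)
  X-vanishing zero    zero    _ = refl
  X-vanishing zero    (suc j) (s≤s ())
  X-vanishing (suc i) j       (s≤s ())

  Y-vanishing : VanishesBelow 1 (Y R)
  Y-vanishing zero    zero    _ = refl
  Y-vanishing zero    (suc j) (s≤s ())
  Y-vanishing (suc i) j       (s≤s ())

  constant : Carrier → Series R
  constant s = monomial s 0 0

  constant-* : ∀ s A i j → (constant s *₂ A) i j ≈ s * A i j
  constant-* s A i j = monomial-*-inside s 0 0 A i j z≤n z≤n

  inX : (ℕ → Carrier) → Series R
  inX h i zero    = h i
  inX h i (suc _) = 0#

  inY : (ℕ → Carrier) → Series R
  inY h zero    j = h j
  inY h (suc _) j = 0#

  inX-* : ∀ h A i j → (inX h *₂ A) i j ≈ ∑ i (λ k → h k * A (i ∸ k) j)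
  inX-* h A i j = trans (*-coeff (inX h) A i j) (∑-cong i (λ k → ∑-single j 0 _ z≤n off-axis))
    where
    off-axis : ∀ {k} l → l ≤ j → l ≢ 0 → inX h k l * A (i ∸ k) (j ∸ l) ≈ 0#
    off-axis zero    _ l≢0 = ⊥-elim (l≢0 ≡.refl)
    off-axis (suc l) _ _   = zeroˡ _

  inY-* : ∀ h A i j → (inY h *₂ A) i j ≈ ∑ j (λ l → h l * A i (j ∸ l))
  inY-* h A i j = trans (*-coeff (inY h) A i j) (∑-single i 0 _ z≤n off-axis)
    where
    off-axis : ∀ k → k ≤ i → k ≢ 0 → ∑ j (λ l → inY h k l * A (i ∸ k) (j ∸ l)) ≈ 0#
    off-axis zero    _ k≢0 = ⊥-elim (k≢0 ≡.refl)
    off-axis (suc k) _ _   = ∑-zero j (λ l _ → zeroˡ _)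

  module ∑₂ = FiniteSums R₂
  open import Algebra.Properties.CommutativeSemigroup R₂.*-commutativeSemigroup using (x∙yz≈y∙xz)

  polyCompose : ℕ → ℕ → (ℕ → ℕ → Carrier) → Series R → Series R → Series R
  polyCompose M₁ M₂ H P Q = ∑₂ M₁ (λ k → ∑₂ M₂ (λ l → constant (H k l) *₂ (P ^ k *₂ Q ^ l)))

  polyCompose-coeff : ∀ M₁ M₂ H P Q i j →
    polyCompose M₁ M₂ H P Q i j ≈ ∑ M₁ (λ k → ∑ M₂ (λ l → H k l * (P ^ k *₂ Q ^ l) i j))
  polyCompose-coeff M₁ M₂ H P Q i j = trans (∑₂-coeff M₁ _ i j) (∑-cong M₁ (λ k →
    trans (∑₂-coeff M₂ _ i j) (∑-cong M₂ (λ l → constant-* (H k l) (P ^ k *₂ Q ^ l) i j))))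

  compose-coeff : ∀ H P Q i j →
    compose R H P Q i j ≈ ∑ (i ℕ.+ j) (λ k → ∑ (i ℕ.+ j) (λ l → H k l * (P ^ k *₂ Q ^ l) i j))
  compose-coeff H P Q i j = ∑-cong (i ℕ.+ j) (λ k → ∑-cong (i ℕ.+ j) (λ l → *-congˡ
    (trans (mulS≈* (powS R P k) (powS R Q l) i j) (R₂.*-cong (powS≈^ P k) (powS≈^ Q l) i j))))

  -- Beyond total degree i + j every term P^k Q^l vanishes at (i, j), so the truncation bound is immaterial.
  compose≈polyCompose : ∀ H {P Q} M₁ M₂ {M} → VanishesBelow 1 P → VanishesBelow 1 Q → M ≤ M₁ → M ≤ M₂ →
    Agree< (suc M) (compose R H P Q) (polyCompose M₁ M₂ H P Q)
  compose≈polyCompose H {P} {Q} M₁ M₂ P≈0 Q≈0 M≤M₁ M≤M₂ i j (s≤s i+j≤M) = begin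
    compose R H P Q i j
      ≈⟨ compose-coeff H P Q i j ⟩
    ∑ (i ℕ.+ j) (λ k → ∑ (i ℕ.+ j) (term k))
      ≈⟨ ∑-cong (i ℕ.+ j) (λ k → sym (∑-extend (i ℕ.+ j) M₂ (term k) (ℕₚ.≤-trans i+j≤M M≤M₂)
           (λ l i+j<l _ → term-vanishes k l (ℕₚ.<-≤-trans i+j<l (ℕₚ.m≤n+m l k))))) ⟩
    ∑ (i ℕ.+ j) (λ k → ∑ M₂ (term k))
      ≈⟨ sym (∑-extend (i ℕ.+ j) M₁ (λ k → ∑ M₂ (term k)) (ℕₚ.≤-trans i+j≤M M≤M₁)
           (λ k i+j<k _ → ∑-zero M₂ (λ l _ → term-vanishes k l (ℕₚ.<-≤-trans i+j<k (ℕₚ.m≤m+n k l))))) ⟩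
    ∑ M₁ (λ k → ∑ M₂ (term k))
      ≈⟨ sym (polyCompose-coeff M₁ M₂ H P Q i j) ⟩
    polyCompose M₁ M₂ H P Q i j   ∎
    where
    term : ℕ → ℕ → Carrier
    term k l = H k l * (P ^ k *₂ Q ^ l) i j
    term-vanishes : ∀ k l → i ℕ.+ j < k ℕ.+ l → term k l ≈ 0#
    term-vanishes k l i+j<k+l =
      trans (*-congˡ (vanishing-* k l (vanishing-^ k P≈0) (vanishing-^ l Q≈0) i j i+j<k+l)) (zeroʳ _)

  row₀ : (ℕ → ℕ → Carrier) → ℕ → ℕ → Carrier
  row₀ H zero    l = H 0 l
  row₀ H (suc k) l = 0#

  polyCompose-unfold : ∀ M₁ M₂ H P Q →
    polyCompose (suc M₁) M₂ H P Q ≈₂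
    polyCompose (suc M₁) M₂ (row₀ H) P Q +₂ P *₂ polyCompose M₁ M₂ (λ k → H (suc k)) P Q
  polyCompose-unfold M₁ M₂ H P Q = R₂.trans (∑₂.∑-unfoldˡ M₁ _) (R₂.+-cong first-row later-rows)
    where
    first-row : ∑₂ M₂ (λ l → constant (H 0 l) *₂ (P ^ 0 *₂ Q ^ l)) ≈₂ polyCompose (suc M₁) M₂ (row₀ H) P Q
    first-row = R₂.sym (R₂.trans (∑₂.∑-unfoldˡ M₁ _) (R₂.trans (R₂.+-congˡ (∑₂.∑-zero M₁ (λ k _ → ∑₂.∑-zero M₂ (λ l _ i j →
      trans (constant-* 0# (P ^ suc k *₂ Q ^ l) i j) (zeroˡ _))))) (R₂.+-identityʳ _)))
    later-rows : ∑₂ M₁ (λ k → ∑₂ M₂ (λ l → constant (H (suc k) l) *₂ (P ^ suc k *₂ Q ^ l))) ≈₂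
                 P *₂ polyCompose M₁ M₂ (λ k → H (suc k)) P Q
    later-rows = R₂.sym (R₂.trans (∑₂.*-distribˡ-∑ M₁ P _) (∑₂.∑-cong M₁ (λ k → R₂.trans (∑₂.*-distribˡ-∑ M₂ P _)
      (∑₂.∑-cong M₂ (λ l → R₂.trans (x∙yz≈y∙xz P (constant (H (suc k) l)) (P ^ k *₂ Q ^ l))
                                     (R₂.*-congˡ {constant (H (suc k) l)} (R₂.sym (R₂.*-assoc P (P ^ k) (Q ^ l)))))))))

  compose-unfold : ∀ H {P Q} → VanishesBelow 1 P → VanishesBelow 1 Q →
    compose R H P Q ≈₂ compose R (row₀ H) P Q +₂ P *₂ compose R (λ k → H (suc k)) P Q
  compose-unfold H {P} {Q} P≈0 Q≈0 i j = begin
    compose R H P Q i j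
      ≈⟨ compose≈polyCompose H (suc N) N P≈0 Q≈0 (ℕₚ.n≤1+n N) ℕₚ.≤-refl i j ℕₚ.≤-refl ⟩
    polyCompose (suc N) N H P Q i j
      ≈⟨ polyCompose-unfold N N H P Q i j ⟩
    (polyCompose (suc N) N (row₀ H) P Q +₂ P *₂ polyCompose N N (λ k → H (suc k)) P Q) i j
      ≈⟨ sym (+-cong (compose≈polyCompose (row₀ H) (suc N) N P≈0 Q≈0 (ℕₚ.n≤1+n N) ℕₚ.≤-refl i j ℕₚ.≤-refl)
                     (*-agree (suc N) (λ _ _ _ → refl)
                        (compose≈polyCompose (λ k → H (suc k)) N N P≈0 Q≈0 ℕₚ.≤-refl ℕₚ.≤-refl) i j ℕₚ.≤-refl)) ⟩
    (compose R (row₀ H) P Q +₂ P *₂ compose R (λ k → H (suc k)) P Q) i j   ∎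
    where N = i ℕ.+ j

  compose-cong : ∀ {H H′} P Q → (∀ k l → H k l ≈ H′ k l) → compose R H P Q ≈₂ compose R H′ P Q
  compose-cong P Q H≈H′ i j = ∑-cong (i ℕ.+ j) (λ k → ∑-cong (i ℕ.+ j) (λ l → *-congʳ (H≈H′ k l)))

  compose-swap : ∀ H P Q → compose R H P Q ≈₂ compose R (λ k l → H l k) Q P
  compose-swap H P Q i j = trans (∑-comm (i ℕ.+ j) (i ℕ.+ j) _) (∑-cong (i ℕ.+ j) (λ l → ∑-cong (i ℕ.+ j) (λ k → *-congˡ
    (trans (mulS≈* (powS R P k) (powS R Q l) i j)
           (trans (R₂.*-comm (powS R P k) (powS R Q l) i j) (sym (mulS≈* (powS R Q l) (powS R P k) i j)))))))

  compose-row₀ : ∀ H P Q i j → compose R (row₀ H) P Q i j ≈ ∑ (i ℕ.+ j) (λ l → H 0 l * (Q ^ l) i j)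
  compose-row₀ H P Q i j = begin
    compose R (row₀ H) P Q i j
      ≈⟨ compose-coeff (row₀ H) P Q i j ⟩
    ∑ (i ℕ.+ j) (λ k → ∑ (i ℕ.+ j) (λ l → row₀ H k l * (P ^ k *₂ Q ^ l) i j))
      ≈⟨ ∑-single (i ℕ.+ j) 0 _ z≤n (λ { zero    _ k≢0 → ⊥-elim (k≢0 ≡.refl)
                                       ; (suc k) _ _   → ∑-zero (i ℕ.+ j) (λ l _ → zeroˡ _) }) ⟩
    ∑ (i ℕ.+ j) (λ l → H 0 l * (1₂ *₂ Q ^ l) i j)
      ≈⟨ ∑-cong (i ℕ.+ j) (λ l → *-congˡ (R₂.*-identityˡ (Q ^ l) i j)) ⟩
    ∑ (i ℕ.+ j) (λ l → H 0 l * (Q ^ l) i j)   ∎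

  compose-row₀-Y : ∀ H P → compose R (row₀ H) P (Y R) ≈₂ inY (H 0)
  compose-row₀-Y H P i j = begin
    compose R (row₀ H) P (Y R) i j                      ≈⟨ compose-row₀ H P (Y R) i j ⟩
    ∑ (i ℕ.+ j) (λ l → H 0 l * (Y R ^ l) i j)           ≈⟨ ∑-cong (i ℕ.+ j) (λ l → *-congˡ (Y^≈monomial l i j)) ⟩
    ∑ (i ℕ.+ j) (λ l → H 0 l * monomial 1# 0 l i j)     ≈⟨ ∑-single (i ℕ.+ j) j _ (ℕₚ.m≤n+m j i) (λ l _ l≢j →
                                                             trans (*-congˡ (monomial-off 1# 0 l i j (inj₂ (l≢j ∘ ≡.sym)))) (zeroʳ _)) ⟩
    H 0 j * monomial 1# 0 j i j                         ≈⟨ on-axis i ⟩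
    inY (H 0) i j                                       ∎
    where
    on-axis : ∀ i → H 0 j * monomial 1# 0 j i j ≈ inY (H 0) i j
    on-axis zero    = trans (*-congˡ (monomial-on 1# 0 j)) (*-identityʳ _)
    on-axis (suc i) = trans (*-congˡ (monomial-off 1# 0 j (suc i) j (inj₁ (λ ())))) (zeroʳ _)

  compose-row₀-X : ∀ H P → compose R (row₀ H) P (X R) ≈₂ inX (H 0)
  compose-row₀-X H P i j = begin
    compose R (row₀ H) P (X R) i j                      ≈⟨ compose-row₀ H P (X R) i j ⟩
    ∑ (i ℕ.+ j) (λ l → H 0 l * (X R ^ l) i j)           ≈⟨ ∑-cong (i ℕ.+ j) (λ l → *-congˡ (X^≈monomial l i j)) ⟩
    ∑ (i ℕ.+ j) (λ l → H 0 l * monomial 1# l 0 i j)     ≈⟨ ∑-single (i ℕ.+ j) i _ (ℕₚ.m≤m+n i j) (λ l _ l≢i →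
                                                             trans (*-congˡ (monomial-off 1# l 0 i j (inj₁ (l≢i ∘ ≡.sym)))) (zeroʳ _)) ⟩
    H 0 i * monomial 1# i 0 i j                         ≈⟨ on-axis j ⟩
    inX (H 0) i j                                       ∎
    where
    on-axis : ∀ j → H 0 i * monomial 1# i 0 i j ≈ inX (H 0) i j
    on-axis zero    = trans (*-congˡ (monomial-on 1# i 0)) (*-identityʳ _)
    on-axis (suc j) = trans (*-congˡ (monomial-off 1# i 0 i (suc j) (inj₂ (λ ())))) (zeroʳ _)

  oneS≈1 : oneS R ≈₂ 1₂
  oneS≈1 zero    zero    = refl
  oneS≈1 zero    (suc j) = refl
  oneS≈1 (suc i) j       = refl

  inverse⇒*≈1 : ∀ A B → IsInverseOf R B A → A *₂ B ≈₂ 1₂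
  inverse⇒*≈1 A B AB≈1 = R₂.trans (R₂.sym (mulS≈* A B)) (R₂.trans AB≈1 oneS≈1)

module ReciprocalIdentity {c ℓ : Level} (R : CommutativeRing c ℓ) where

  open CommutativeRing R
  open import Relation.Binary.Reasoning.Setoid setoid
  open import Algebra.Solver.Ring.NaturalCoefficients.Default commutativeSemiring using (solve; _:=_; _:+_; _:*_)

  elimination-identity : ∀ {f₀ g₀ f̃ g̃ z k l p q} →
    f̃ ≈ f₀ + p → g̃ ≈ g₀ + q → z ≈ g̃ * k →
    g₀ * k ≈ f₀ * g₀ + p * l → f₀ * l ≈ f₀ * g₀ + q * k →
    z * (f₀ * g̃ + f̃ * g₀) ≈ (f₀ * g₀) * (f̃ * g̃) + z * (f̃ * g̃)
  elimination-identity {f₀} {g₀} {f̃} {g̃} {z} {k} {l} {p} {q} f̃≈ g̃≈ z≈ g₀k≈ f₀l≈ = begin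
    z * (f₀ * g̃ + f̃ * g₀)
      ≈⟨ *-cong z≈ (+-cong (*-congˡ g̃≈) (*-congʳ f̃≈)) ⟩
    g̃ * k * (f₀ * (g₀ + q) + (f₀ + p) * g₀)
      ≈⟨ solve 6 (λ g̃ k f₀ g₀ p q → g̃ :* k :* (f₀ :* (g₀ :+ q) :+ (f₀ :+ p) :* g₀)
                                    := g̃ :* (f₀ :* (g₀ :* k)) :+ g̃ :* k :* (f₀ :* q :+ f₀ :* g₀ :+ p :* g₀)) refl g̃ k f₀ g₀ p q ⟩
    g̃ * (f₀ * (g₀ * k)) + g̃ * k * (f₀ * q + f₀ * g₀ + p * g₀)
      ≈⟨ +-congʳ (*-congˡ f₀g₀k≈) ⟩
    g̃ * ((f₀ * g₀) * (f₀ + p) + p * (q * k)) + g̃ * k * (f₀ * q + f₀ * g₀ + p * g₀)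
      ≈⟨ solve 6 (λ g̃ k f₀ g₀ p q → g̃ :* ((f₀ :* g₀) :* (f₀ :+ p) :+ p :* (q :* k))
                                      :+ g̃ :* k :* (f₀ :* q :+ f₀ :* g₀ :+ p :* g₀)
                                    := (f₀ :* g₀) :* ((f₀ :+ p) :* g̃) :+ g̃ :* k :* ((f₀ :+ p) :* (g₀ :+ q)))
                 refl g̃ k f₀ g₀ p q ⟩
    (f₀ * g₀) * ((f₀ + p) * g̃) + g̃ * k * ((f₀ + p) * (g₀ + q))
      ≈⟨ sym (+-cong (*-congˡ (*-congʳ f̃≈)) (*-cong z≈ (*-cong f̃≈ g̃≈))) ⟩
    (f₀ * g₀) * (f̃ * g̃) + z * (f̃ * g̃)   ∎
    where
    f₀g₀k≈ : f₀ * (g₀ * k) ≈ (f₀ * g₀) * (f₀ + p) + p * (q * k)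
    f₀g₀k≈ = begin
      f₀ * (g₀ * k)                             ≈⟨ *-congˡ g₀k≈ ⟩
      f₀ * (f₀ * g₀ + p * l)
        ≈⟨ solve 4 (λ f₀ g₀ p l → f₀ :* (f₀ :* g₀ :+ p :* l) := f₀ :* (f₀ :* g₀) :+ p :* (f₀ :* l)) refl f₀ g₀ p l ⟩
      f₀ * (f₀ * g₀) + p * (f₀ * l)
        ≈⟨ +-congˡ (*-congˡ f₀l≈) ⟩
      f₀ * (f₀ * g₀) + p * (f₀ * g₀ + q * k)
        ≈⟨ solve 5 (λ f₀ g₀ p q k → f₀ :* (f₀ :* g₀) :+ p :* (f₀ :* g₀ :+ q :* k) := (f₀ :* g₀) :* (f₀ :+ p) :+ p :* (q :* k))
                   refl f₀ g₀ p q k ⟩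
      (f₀ * g₀) * (f₀ + p) + p * (q * k)   ∎

  reciprocal-identity : ∀ {f₀ g₀ f̃ g̃ z P Q S T} →
    z * (f₀ * g̃ + f̃ * g₀) ≈ (f₀ * g₀) * (f̃ * g̃) + z * (f̃ * g̃) →
    z * P ≈ 1# → (f̃ * g₀) * Q ≈ 1# → (f₀ * g̃) * S ≈ 1# → (f₀ * g₀) * T ≈ 1# →
    P ≈ Q + S - T
  reciprocal-identity {f₀} {g₀} {f̃} {g̃} {z} {P} {Q} {S} {T} identity zP≈1 aQ≈1 bS≈1 cT≈1 = begin
    P                 ≈⟨ sym (+-identityʳ P) ⟩
    P + 0#            ≈⟨ +-congˡ (sym (-‿inverseʳ T)) ⟩
    P + (T - T)       ≈⟨ sym (+-assoc P T (- T)) ⟩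
    P + T - T         ≈⟨ +-congʳ (sym Q+S≈P+T) ⟩
    Q + S - T         ∎
    where
    T≈QSd : T ≈ Q * S * (f̃ * g̃)
    T≈QSd = begin
      T
        ≈⟨ sym (trans (*-congˡ (trans (*-cong aQ≈1 bS≈1) (*-identityˡ 1#))) (*-identityʳ T)) ⟩
      T * ((f̃ * g₀) * Q * ((f₀ * g̃) * S))
        ≈⟨ solve 7 (λ T f̃ g₀ Q f₀ g̃ S → T :* ((f̃ :* g₀) :* Q :* ((f₀ :* g̃) :* S)) := (f₀ :* g₀) :* T :* (Q :* S :* (f̃ :* g̃)))
                   refl T f̃ g₀ Q f₀ g̃ S ⟩
      (f₀ * g₀) * T * (Q * S * (f̃ * g̃))
        ≈⟨ trans (*-congʳ cT≈1) (*-identityˡ _) ⟩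
      Q * S * (f̃ * g̃)   ∎
    Q+S≈P+T : Q + S ≈ P + T
    Q+S≈P+T = begin
      Q + S
        ≈⟨ sym (trans (*-congˡ zP≈1) (trans (*-identityʳ _)
                 (+-cong (trans (*-congˡ bS≈1) (*-identityʳ Q)) (trans (*-congʳ aQ≈1) (*-identityˡ S))))) ⟩
      (Q * ((f₀ * g̃) * S) + ((f̃ * g₀) * Q) * S) * (z * P)
        ≈⟨ solve 8 (λ Q f₀ g̃ S f̃ g₀ z P → (Q :* ((f₀ :* g̃) :* S) :+ ((f̃ :* g₀) :* Q) :* S) :* (z :* P)
                                          := P :* Q :* S :* (z :* (f₀ :* g̃ :+ f̃ :* g₀))) refl Q f₀ g̃ S f̃ g₀ z P ⟩
      P * Q * S * (z * (f₀ * g̃ + f̃ * g₀))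
        ≈⟨ *-congˡ identity ⟩
      P * Q * S * ((f₀ * g₀) * (f̃ * g̃) + z * (f̃ * g̃))
        ≈⟨ solve 8 (λ P Q S f₀ g₀ f̃ g̃ z → P :* Q :* S :* ((f₀ :* g₀) :* (f̃ :* g̃) :+ z :* (f̃ :* g̃))
                                          := P :* ((f̃ :* g₀) :* Q :* ((f₀ :* g̃) :* S)) :+ z :* P :* (Q :* S :* (f̃ :* g̃)))
                   refl P Q S f₀ g₀ f̃ g̃ z ⟩
      P * ((f̃ * g₀) * Q * ((f₀ * g̃) * S)) + z * P * (Q * S * (f̃ * g̃))
        ≈⟨ +-cong (trans (*-congˡ (trans (*-cong aQ≈1 bS≈1) (*-identityˡ 1#))) (*-identityʳ P))
                  (trans (*-cong zP≈1 (sym T≈QSd)) (*-identityˡ T)) ⟩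
      P + T   ∎

module ConvolutionSeries {c ℓ : Level} (R : CommutativeRing c ℓ) (f g : ℕ → ℕ → CommutativeRing.Carrier R) where

  open CommutativeRing R hiding (zero)
  module ≈-Reasoning = Relation.Binary.Reasoning.Setoid setoid
  open FiniteSums R
  open BivariateSeries R

  -- conv I J p q is the sum over the interval [a₁⋯a_I, x₁⋯x_J] of f(u,v) g(v,w), except that the
  -- leading factor f_{ij} of f(u,v) is replaced by f_{i,j+p} and the leading factor g_{ij} of g(v,w)
  -- by g_{i+q,j}.  Splitting v by its first letter gives the recursion: convA collects the v that
  -- start with an a-letter preceded by r deleted a-letters, convX those that start with an x-letter
  -- preceded by s missing x-letters.
  mutual
    conv : ℕ → ℕ → ℕ → ℕ → Carrier
    conv I J p q = f I p * g q J + convA I J p q 0 + convX I J p q 0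

    convA : ℕ → ℕ → ℕ → ℕ → ℕ → Carrier
    convA zero    J p q r = 0#
    convA (suc I) J p q r = f r p * conv I J 0 (suc q) + convA I J p q (suc r)

    convX : ℕ → ℕ → ℕ → ℕ → ℕ → Carrier
    convX I zero    p q s = 0#
    convX I (suc J) p q s = g q s * conv I J (suc p) 0 + convX I J p q (suc s)

  convA-closed : ∀ I J p q r → convA (suc I) J p q r ≈ ∑ I (λ k → f (r ℕ.+ k) p * conv (I ∸ k) J 0 (suc q))
  convA-closed zero    J p q r = trans (+-identityʳ _) (*-congʳ (reflexive (≡.cong (λ i → f i p) (≡.sym (ℕₚ.+-identityʳ r)))))
  convA-closed (suc I) J p q r = begin
    f r p * conv (suc I) J 0 (suc q) + convA (suc I) J p q (suc r)
      ≈⟨ +-cong (*-congʳ (reflexive (≡.cong (λ i → f i p) (≡.sym (ℕₚ.+-identityʳ r))))) (convA-closed I J p q (suc r)) ⟩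
    f (r ℕ.+ 0) p * conv (suc I) J 0 (suc q) + ∑ I (λ k → f (suc r ℕ.+ k) p * conv (I ∸ k) J 0 (suc q))
      ≈⟨ +-congˡ (∑-cong I (λ k → *-congʳ (reflexive (≡.cong (λ i → f i p) (≡.sym (ℕₚ.+-suc r k)))))) ⟩
    f (r ℕ.+ 0) p * conv (suc I) J 0 (suc q) + ∑ I (λ k → f (r ℕ.+ suc k) p * conv (I ∸ k) J 0 (suc q))
      ≈⟨ sym (∑-unfoldˡ I _) ⟩
    ∑ (suc I) (λ k → f (r ℕ.+ k) p * conv (suc I ∸ k) J 0 (suc q))   ∎
    where open ≈-Reasoning

  convX-closed : ∀ I J p q s → convX I (suc J) p q s ≈ ∑ J (λ l → g q (s ℕ.+ l) * conv I (J ∸ l) (suc p) 0)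
  convX-closed I zero    p q s = trans (+-identityʳ _) (*-congʳ (reflexive (≡.cong (g q) (≡.sym (ℕₚ.+-identityʳ s)))))
  convX-closed I (suc J) p q s = begin
    g q s * conv I (suc J) (suc p) 0 + convX I (suc J) p q (suc s)
      ≈⟨ +-cong (*-congʳ (reflexive (≡.cong (g q) (≡.sym (ℕₚ.+-identityʳ s))))) (convX-closed I J p q (suc s)) ⟩
    g q (s ℕ.+ 0) * conv I (suc J) (suc p) 0 + ∑ J (λ l → g q (suc s ℕ.+ l) * conv I (J ∸ l) (suc p) 0)
      ≈⟨ +-congˡ (∑-cong J (λ l → *-congʳ (reflexive (≡.cong (g q) (≡.sym (ℕₚ.+-suc s l)))))) ⟩
    g q (s ℕ.+ 0) * conv I (suc J) (suc p) 0 + ∑ J (λ l → g q (s ℕ.+ suc l) * conv I (J ∸ l) (suc p) 0)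
      ≈⟨ sym (∑-unfoldˡ J _) ⟩
    ∑ (suc J) (λ l → g q (s ℕ.+ l) * conv I (suc J ∸ l) (suc p) 0)   ∎
    where open ≈-Reasoning

  Fᵖ : ℕ → Series R
  Fᵖ p = inX (λ i → f i p)

  Gᵠ : ℕ → Series R
  Gᵠ q = inY (g q)

  Φ : ℕ → ℕ → Series R
  Φ p q I J = conv I J p q

  Fᵖ*Gᵠ-coeff : ∀ p q I J → (Fᵖ p *₂ Gᵠ q) I J ≈ f I p * g q J
  Fᵖ*Gᵠ-coeff p q I J = trans (inX-* _ (Gᵠ q) I J)
    (trans (∑-single I I _ ℕₚ.≤-refl off-diagonal) (*-congˡ (reflexive (≡.cong (λ i → Gᵠ q i J) (ℕₚ.n∸n≡0 I)))))
    where
    inY-off : ∀ n → 0 < n → Gᵠ q n J ≈ 0#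
    inY-off (suc n) _ = refl
    off-diagonal : ∀ k → k ≤ I → k ≢ I → f k p * Gᵠ q (I ∸ k) J ≈ 0#
    off-diagonal k k≤I k≢I = trans (*-congˡ (inY-off (I ∸ k) (ℕₚ.m<n⇒0<n∸m (ℕₚ.≤∧≢⇒< k≤I k≢I)))) (zeroʳ _)

  convA-coeff : ∀ p q I J → convA I J p q 0 ≈ (X R *₂ (Fᵖ p *₂ Φ 0 (suc q))) I J
  convA-coeff p q zero    J = sym (X-*-zero (Fᵖ p *₂ Φ 0 (suc q)) J)
  convA-coeff p q (suc I) J = begin
    convA (suc I) J p q 0                          ≈⟨ convA-closed I J p q 0 ⟩
    ∑ I (λ k → f k p * conv (I ∸ k) J 0 (suc q))   ≈⟨ sym (inX-* _ (Φ 0 (suc q)) I J) ⟩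
    (Fᵖ p *₂ Φ 0 (suc q)) I J                      ≈⟨ sym (X-*-suc (Fᵖ p *₂ Φ 0 (suc q)) I J) ⟩
    (X R *₂ (Fᵖ p *₂ Φ 0 (suc q))) (suc I) J       ∎
    where open ≈-Reasoning

  convX-coeff : ∀ p q I J → convX I J p q 0 ≈ (Y R *₂ (Gᵠ q *₂ Φ (suc p) 0)) I J
  convX-coeff p q I zero    = sym (Y-*-zero (Gᵠ q *₂ Φ (suc p) 0) I)
  convX-coeff p q I (suc J) = begin
    convX I (suc J) p q 0                          ≈⟨ convX-closed I J p q 0 ⟩
    ∑ J (λ l → g q l * conv I (J ∸ l) (suc p) 0)   ≈⟨ sym (inY-* (g q) (Φ (suc p) 0) I J) ⟩
    (Gᵠ q *₂ Φ (suc p) 0) I J                      ≈⟨ sym (Y-*-suc (Gᵠ q *₂ Φ (suc p) 0) I J) ⟩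
    (Y R *₂ (Gᵠ q *₂ Φ (suc p) 0)) I (suc J)       ∎
    where open ≈-Reasoning

  Φ-rec : ∀ p q → Φ p q ≈₂ Fᵖ p *₂ Gᵠ q +₂ X R *₂ (Fᵖ p *₂ Φ 0 (suc q)) +₂ Y R *₂ (Gᵠ q *₂ Φ (suc p) 0)
  Φ-rec p q I J = +-cong (+-cong (sym (Fᵖ*Gᵠ-coeff p q I J)) (convA-coeff p q I J)) (convX-coeff p q I J)

  F₀ G₀ F₀x G₀y F̃ G̃ K L : Series R
  F₀ = atY0 R f
  G₀ = atX0 R g
  F₀x = mulS R F₀ (X R)
  G₀y = mulS R G₀ (Y R)
  F̃ = compose R f (X R) G₀y
  G̃ = compose R g F₀x (Y R)
  K = F₀ +₂ Y R *₂ Φ 1 0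
  L = G₀ +₂ X R *₂ Φ 0 1

  Γ : ℕ → Series R
  Γ q = compose R (λ k l → g (q ℕ.+ k) l) F₀x (Y R)

  Δ : ℕ → Series R
  Δ p = compose R (λ k l → f l (p ℕ.+ k)) G₀y (X R)

  F₀≈Fᵖ0 : F₀ ≈₂ Fᵖ 0
  F₀≈Fᵖ0 i zero    = refl
  F₀≈Fᵖ0 i (suc j) = refl

  G₀≈Gᵠ0 : G₀ ≈₂ Gᵠ 0
  G₀≈Gᵠ0 zero    j = refl
  G₀≈Gᵠ0 (suc i) j = refl

  F₀x-vanishing : VanishesBelow 1 F₀x
  F₀x-vanishing = vanishing-cong 1 (R₂.sym (mulS≈* F₀ (X R))) (vanishing-* 0 1 (λ _ _ ()) X-vanishing)

  G₀y-vanishing : VanishesBelow 1 G₀y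
  G₀y-vanishing = vanishing-cong 1 (R₂.sym (mulS≈* G₀ (Y R))) (vanishing-* 0 1 (λ _ _ ()) Y-vanishing)

  Γ-rec : ∀ q → Γ q ≈₂ Gᵠ q +₂ F₀x *₂ Γ (suc q)
  Γ-rec q = R₂.trans (compose-unfold H F₀x-vanishing Y-vanishing)
                     (R₂.+-cong (R₂.trans (compose-row₀-Y H F₀x) leading)
                                (R₂.*-congˡ {F₀x} (compose-cong F₀x (Y R) shift)))
    where
    H : ℕ → ℕ → Carrier
    H k l = g (q ℕ.+ k) l
    leading : inY (H 0) ≈₂ Gᵠ q
    leading zero    j = reflexive (≡.cong (λ i → g i j) (ℕₚ.+-identityʳ q))
    leading (suc i) j = refl
    shift : ∀ k l → H (suc k) l ≈ g (suc q ℕ.+ k) l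
    shift k l = reflexive (≡.cong (λ i → g i l) (ℕₚ.+-suc q k))

  Δ-rec : ∀ p → Δ p ≈₂ Fᵖ p +₂ G₀y *₂ Δ (suc p)
  Δ-rec p = R₂.trans (compose-unfold H G₀y-vanishing X-vanishing)
                     (R₂.+-cong (R₂.trans (compose-row₀-X H G₀y) leading)
                                (R₂.*-congˡ {G₀y} (compose-cong G₀y (X R) shift)))
    where
    H : ℕ → ℕ → Carrier
    H k l = f l (p ℕ.+ k)
    leading : inX (H 0) ≈₂ Fᵖ p
    leading i zero    = reflexive (≡.cong (f i) (ℕₚ.+-identityʳ p))
    leading i (suc j) = refl
    shift : ∀ k l → H (suc k) l ≈ f l (suc p ℕ.+ k)
    shift k l = reflexive (≡.cong (f l) (ℕₚ.+-suc p k))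

  open import Algebra.Solver.Ring.NaturalCoefficients.Default R₂.commutativeSemiring using (solve; _:=_; _:+_; _:*_)

  module ≈₂-Reasoning = Relation.Binary.Reasoning.Setoid R₂.setoid

  Φ0q-rec : ∀ q → Φ 0 q ≈₂ Gᵠ q *₂ K +₂ F₀x *₂ Φ 0 (suc q)
  Φ0q-rec q = begin
    Φ 0 q
      ≈⟨ Φ-rec 0 q ⟩
    Fᵖ 0 *₂ Gᵠ q +₂ X R *₂ (Fᵖ 0 *₂ Φ 0 (suc q)) +₂ Y R *₂ (Gᵠ q *₂ Φ 1 0)
      ≈⟨ R₂.+-congʳ (R₂.+-cong (R₂.*-congʳ {Gᵠ q} (R₂.sym F₀≈Fᵖ0))
                               (R₂.*-congˡ {X R} (R₂.*-congʳ {Φ 0 (suc q)} (R₂.sym F₀≈Fᵖ0)))) ⟩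
    F₀ *₂ Gᵠ q +₂ X R *₂ (F₀ *₂ Φ 0 (suc q)) +₂ Y R *₂ (Gᵠ q *₂ Φ 1 0)
      ≈⟨ solve 6 (λ F₀ G Xs Ys A B → F₀ :* G :+ Xs :* (F₀ :* A) :+ Ys :* (G :* B)
                                     := G :* (F₀ :+ Ys :* B) :+ (F₀ :* Xs) :* A)
                 R₂.refl F₀ (Gᵠ q) (X R) (Y R) (Φ 0 (suc q)) (Φ 1 0) ⟩
    Gᵠ q *₂ K +₂ (F₀ *₂ X R) *₂ Φ 0 (suc q)
      ≈⟨ R₂.+-congˡ (R₂.*-congʳ {Φ 0 (suc q)} (R₂.sym (mulS≈* F₀ (X R)))) ⟩
    Gᵠ q *₂ K +₂ F₀x *₂ Φ 0 (suc q)   ∎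
    where open ≈₂-Reasoning

  Φp0-rec : ∀ p → Φ p 0 ≈₂ Fᵖ p *₂ L +₂ G₀y *₂ Φ (suc p) 0
  Φp0-rec p = begin
    Φ p 0
      ≈⟨ Φ-rec p 0 ⟩
    Fᵖ p *₂ Gᵠ 0 +₂ X R *₂ (Fᵖ p *₂ Φ 0 1) +₂ Y R *₂ (Gᵠ 0 *₂ Φ (suc p) 0)
      ≈⟨ R₂.+-cong (R₂.+-congʳ (R₂.*-congˡ {Fᵖ p} (R₂.sym G₀≈Gᵠ0)))
                   (R₂.*-congˡ {Y R} (R₂.*-congʳ {Φ (suc p) 0} (R₂.sym G₀≈Gᵠ0))) ⟩
    Fᵖ p *₂ G₀ +₂ X R *₂ (Fᵖ p *₂ Φ 0 1) +₂ Y R *₂ (G₀ *₂ Φ (suc p) 0)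
      ≈⟨ solve 6 (λ F G₀ Xs Ys A B → F :* G₀ :+ Xs :* (F :* A) :+ Ys :* (G₀ :* B)
                                     := F :* (G₀ :+ Xs :* A) :+ (G₀ :* Ys) :* B)
                 R₂.refl (Fᵖ p) G₀ (X R) (Y R) (Φ 0 1) (Φ (suc p) 0) ⟩
    Fᵖ p *₂ L +₂ (G₀ *₂ Y R) *₂ Φ (suc p) 0
      ≈⟨ R₂.+-congˡ (R₂.*-congʳ {Φ (suc p) 0} (R₂.sym (mulS≈* G₀ (Y R)))) ⟩
    Fᵖ p *₂ L +₂ G₀y *₂ Φ (suc p) 0   ∎
    where open ≈₂-Reasoning

  Φ0q≈ΓK : ∀ q → Φ 0 q ≈₂ Γ q *₂ K
  Φ0q≈ΓK = recursion-solution K F₀x-vanishing Γ-rec Φ0q-rec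

  Φp0≈ΔL : ∀ p → Φ p 0 ≈₂ Δ p *₂ L
  Φp0≈ΔL = recursion-solution L G₀y-vanishing Δ-rec Φp0-rec

  conv-elimination-identity : Φ 0 0 *₂ (F₀ *₂ G̃ +₂ F̃ *₂ G₀) ≈₂ (F₀ *₂ G₀) *₂ (F̃ *₂ G̃) +₂ Φ 0 0 *₂ (F̃ *₂ G̃)
  conv-elimination-identity =
    ReciprocalIdentity.elimination-identity R₂ {F₀} {G₀} {F̃} {G̃} {Φ 0 0} {K} {L} {G₀y *₂ Δ 1} {F₀x *₂ Γ 1}
      F̃≈ G̃≈ (Φ0q≈ΓK 0) G₀K≈ F₀L≈
    where
    open ≈₂-Reasoning
    F̃≈ : F̃ ≈₂ F₀ +₂ G₀y *₂ Δ 1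
    F̃≈ = R₂.trans (compose-swap f (X R) G₀y) (R₂.trans (Δ-rec 0) (R₂.+-congʳ (R₂.sym F₀≈Fᵖ0)))
    G̃≈ : G̃ ≈₂ G₀ +₂ F₀x *₂ Γ 1
    G̃≈ = R₂.trans (Γ-rec 0) (R₂.+-congʳ (R₂.sym G₀≈Gᵠ0))
    G₀K≈ : G₀ *₂ K ≈₂ F₀ *₂ G₀ +₂ (G₀y *₂ Δ 1) *₂ L
    G₀K≈ = begin
      G₀ *₂ (F₀ +₂ Y R *₂ Φ 1 0)
        ≈⟨ R₂.*-congˡ {G₀} (R₂.+-congˡ {F₀} (R₂.*-congˡ {Y R} (Φp0≈ΔL 1))) ⟩
      G₀ *₂ (F₀ +₂ Y R *₂ (Δ 1 *₂ L))
        ≈⟨ solve 5 (λ G₀ F₀ Ys D L → G₀ :* (F₀ :+ Ys :* (D :* L)) := F₀ :* G₀ :+ ((G₀ :* Ys) :* D) :* L)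
                   R₂.refl G₀ F₀ (Y R) (Δ 1) L ⟩
      F₀ *₂ G₀ +₂ ((G₀ *₂ Y R) *₂ Δ 1) *₂ L
        ≈⟨ R₂.+-congˡ {F₀ *₂ G₀} (R₂.*-congʳ {L} (R₂.*-congʳ {Δ 1} (R₂.sym (mulS≈* G₀ (Y R))))) ⟩
      F₀ *₂ G₀ +₂ (G₀y *₂ Δ 1) *₂ L   ∎
    F₀L≈ : F₀ *₂ L ≈₂ F₀ *₂ G₀ +₂ (F₀x *₂ Γ 1) *₂ K
    F₀L≈ = begin
      F₀ *₂ (G₀ +₂ X R *₂ Φ 0 1)
        ≈⟨ R₂.*-congˡ {F₀} (R₂.+-congˡ {G₀} (R₂.*-congˡ {X R} (Φ0q≈ΓK 1))) ⟩
      F₀ *₂ (G₀ +₂ X R *₂ (Γ 1 *₂ K))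
        ≈⟨ solve 5 (λ F₀ G₀ Xs C K → F₀ :* (G₀ :+ Xs :* (C :* K)) := F₀ :* G₀ :+ ((F₀ :* Xs) :* C) :* K)
                   R₂.refl F₀ G₀ (X R) (Γ 1) K ⟩
      F₀ *₂ G₀ +₂ ((F₀ *₂ X R) *₂ Γ 1) *₂ K
        ≈⟨ R₂.+-congˡ {F₀ *₂ G₀} (R₂.*-congʳ {K} (R₂.*-congʳ {Γ 1} (R₂.sym (mulS≈* F₀ (X R))))) ⟩
      F₀ *₂ G₀ +₂ (F₀x *₂ Γ 1) *₂ K   ∎

module ShuffleWords where

  open ≡ using (refl)

  Increasing : List ℕ → Set
  Increasing = Linked _<_

  increasing-head : ∀ {n ns} → Increasing (n ∷ ns) → All (n <_) ns
  increasing-head inc with Linked⇒AllPairs ℕₚ.<-trans inc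
  ... | above ∷ _ = above

  increasing-cons : ∀ {n ns} → All (n <_) ns → Increasing ns → Increasing (n ∷ ns)
  increasing-cons []          _   = [-]
  increasing-cons (n<k ∷ _)   inc = n<k ∷ inc

  increasing-unique : ∀ {ns} → Increasing ns → Unique ns
  increasing-unique inc = AllPairs.map (λ m<n m≡n → ℕₚ.<-irrefl m≡n m<n) (Linked⇒AllPairs ℕₚ.<-trans inc)

  BelowA : ℕ → Word → Set
  BelowA n t = ∀ {k} → a k ∈ t → n < k

  BelowX : ℕ → Word → Set
  BelowX m t = ∀ {k} → x k ∈ t → m < k

  aIdx-∈ : ∀ {k} t → a k ∈ t → k ∈ aIdx t
  aIdx-∈ (a n ∷ t) (here refl) = here refl
  aIdx-∈ (a n ∷ t) (there k∈) = there (aIdx-∈ t k∈)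
  aIdx-∈ (x n ∷ t) (there k∈) = aIdx-∈ t k∈

  aIdx-∈⁻ : ∀ {k} t → k ∈ aIdx t → a k ∈ t
  aIdx-∈⁻ (a n ∷ t) (here refl) = here refl
  aIdx-∈⁻ (a n ∷ t) (there k∈) = there (aIdx-∈⁻ t k∈)
  aIdx-∈⁻ (x n ∷ t) k∈         = there (aIdx-∈⁻ t k∈)

  xIdx-∈ : ∀ {k} t → x k ∈ t → k ∈ xIdx t
  xIdx-∈ (x n ∷ t) (here refl) = here refl
  xIdx-∈ (x n ∷ t) (there k∈) = there (xIdx-∈ t k∈)
  xIdx-∈ (a n ∷ t) (there k∈) = xIdx-∈ t k∈

  xIdx-∈⁻ : ∀ {k} t → k ∈ xIdx t → x k ∈ t
  xIdx-∈⁻ (x n ∷ t) (here refl) = here refl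
  xIdx-∈⁻ (x n ∷ t) (there k∈) = there (xIdx-∈⁻ t k∈)
  xIdx-∈⁻ (a n ∷ t) k∈         = there (xIdx-∈⁻ t k∈)

  shuffle-∷a : ∀ {n t} → IsShuffle t → BelowA n t → IsShuffle (a n ∷ t)
  shuffle-∷a {n} {t} (unique , incA , incX) n<t =
    Allₚ.¬Any⇒All¬ t (λ an∈t → ℕₚ.<-irrefl refl (n<t an∈t)) ∷ unique ,
    increasing-cons (All.tabulate (λ k∈ → n<t (aIdx-∈⁻ t k∈))) incA ,
    incX

  shuffle-∷x : ∀ {m t} → IsShuffle t → BelowX m t → IsShuffle (x m ∷ t)
  shuffle-∷x {m} {t} (unique , incA , incX) m<t =
    Allₚ.¬Any⇒All¬ t (λ xm∈t → ℕₚ.<-irrefl refl (m<t xm∈t)) ∷ unique ,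
    incA ,
    increasing-cons (All.tabulate (λ k∈ → m<t (xIdx-∈⁻ t k∈))) incX

  shuffle-tail : ∀ {l t} → IsShuffle (l ∷ t) → IsShuffle t
  shuffle-tail {a n} (_ ∷ unique , incA , incX) = unique , Linked.tail incA , incX
  shuffle-tail {x n} (_ ∷ unique , incA , incX) = unique , incA , Linked.tail incX

  shuffle-belowA : ∀ {n t} → IsShuffle (a n ∷ t) → BelowA n t
  shuffle-belowA {t = t} (_ , incA , _) ak∈t = All.lookup (increasing-head incA) (aIdx-∈ t ak∈t)

  shuffle-belowX : ∀ {m t} → IsShuffle (x m ∷ t) → BelowX m t
  shuffle-belowX {t = t} (_ , _ , incX) xk∈t = All.lookup (increasing-head incX) (xIdx-∈ t xk∈t)

  aIdx-map-a : ∀ ns → aIdx (map a ns) ≡ ns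
  aIdx-map-a []       = refl
  aIdx-map-a (n ∷ ns) = ≡.cong (n ∷_) (aIdx-map-a ns)

  xIdx-map-a : ∀ ns → xIdx (map a ns) ≡ []
  xIdx-map-a []       = refl
  xIdx-map-a (n ∷ ns) = xIdx-map-a ns

  aIdx-map-x : ∀ ms → aIdx (map x ms) ≡ []
  aIdx-map-x []       = refl
  aIdx-map-x (m ∷ ms) = aIdx-map-x ms

  xIdx-map-x : ∀ ms → xIdx (map x ms) ≡ ms
  xIdx-map-x []       = refl
  xIdx-map-x (m ∷ ms) = ≡.cong (m ∷_) (xIdx-map-x ms)

  shuffle-map-a : ∀ {ns} → Increasing ns → IsShuffle (map a ns)
  shuffle-map-a {ns} inc =
    Uniqueₚ.map⁺ (λ { refl → refl }) (increasing-unique inc) ,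
    ≡.subst Increasing (≡.sym (aIdx-map-a ns)) inc ,
    ≡.subst Increasing (≡.sym (xIdx-map-a ns)) []

  shuffle-map-x : ∀ {ms} → Increasing ms → IsShuffle (map x ms)
  shuffle-map-x {ms} inc =
    Uniqueₚ.map⁺ (λ { refl → refl }) (increasing-unique inc) ,
    ≡.subst Increasing (≡.sym (aIdx-map-x ms)) [] ,
    ≡.subst Increasing (≡.sym (xIdx-map-x ms)) inc

  ⋖-shuffles : ∀ {t t′} → t ⋖ t′ → IsShuffle t × IsShuffle t′
  ⋖-shuffles (delA _ _ _ sh sh′) = sh , sh′
  ⋖-shuffles (insX _ _ _ sh sh′) = sh , sh′

  ⋖-a⁻ : ∀ {t t′ k} → t ⋖ t′ → a k ∈ t′ → a k ∈ t
  ⋖-a⁻ (delA p s n _ _) ak∈ with ∈-++⁻ p ak∈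
  ... | inj₁ ∈p = ∈-++⁺ˡ ∈p
  ... | inj₂ ∈s = ∈-++⁺ʳ p (there ∈s)
  ⋖-a⁻ (insX p s n _ _) ak∈ with ∈-++⁻ p ak∈
  ... | inj₁ ∈p         = ∈-++⁺ˡ ∈p
  ... | inj₂ (there ∈s) = ∈-++⁺ʳ p ∈s

  ⋖-x⁺ : ∀ {t t′ k} → t ⋖ t′ → x k ∈ t → x k ∈ t′
  ⋖-x⁺ (delA p s n _ _) xk∈ with ∈-++⁻ p xk∈
  ... | inj₁ ∈p         = ∈-++⁺ˡ ∈p
  ... | inj₂ (there ∈s) = ∈-++⁺ʳ p ∈s
  ⋖-x⁺ (insX p s n _ _) xk∈ with ∈-++⁻ p xk∈
  ... | inj₁ ∈p = ∈-++⁺ˡ ∈p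
  ... | inj₂ ∈s = ∈-++⁺ʳ p (there ∈s)

  ⋖*-a⁻ : ∀ {t t′ k} → Star _⋖_ t t′ → a k ∈ t′ → a k ∈ t
  ⋖*-a⁻ ε           ak∈ = ak∈
  ⋖*-a⁻ (st ◅ steps) ak∈ = ⋖-a⁻ st (⋖*-a⁻ steps ak∈)

  ⋖*-x⁺ : ∀ {t t′ k} → Star _⋖_ t t′ → x k ∈ t → x k ∈ t′
  ⋖*-x⁺ ε           xk∈ = xk∈
  ⋖*-x⁺ (st ◅ steps) xk∈ = ⋖*-x⁺ steps (⋖-x⁺ st xk∈)

  ⋖-prefix : ∀ l {t t′} → t ⋖ t′ → IsShuffle (l ∷ t) → IsShuffle (l ∷ t′) → (l ∷ t) ⋖ (l ∷ t′)
  ⋖-prefix l (delA p s n _ _) sh sh′ = delA (l ∷ p) s n sh sh′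
  ⋖-prefix l (insX p s n _ _) sh sh′ = insX (l ∷ p) s n sh sh′

  ⋖*-prefix : ∀ l {t t′} → Star _⋖_ t t′ → IsShuffle t →
    (∀ {s} → Star _⋖_ t s → Star _⋖_ s t′ → IsShuffle s → IsShuffle (l ∷ s)) →
    Star _⋖_ (l ∷ t) (l ∷ t′)
  ⋖*-prefix l ε            sh ok = ε
  ⋖*-prefix l (st ◅ steps) sh ok =
    ⋖-prefix l st (ok ε (st ◅ steps) sh) (ok (st ◅ ε) steps sh′) ◅ ⋖*-prefix l steps sh′ (λ before after → ok (st ◅ before) after)
    where sh′ = proj₂ (⋖-shuffles st)

  delete-all : ∀ {ns} → Increasing ns → Star _⋖_ (map a ns) []
  delete-all {[]}     inc = ε
  delete-all {n ∷ ns} inc = delA [] (map a ns) n (shuffle-map-a inc) (shuffle-map-a (Linked.tail inc)) ◅ delete-all (Linked.tail inc)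

  insert-all : ∀ {ms} → Increasing ms → Star _⋖_ [] (map x ms)
  insert-all {[]}     inc = ε
  insert-all {m ∷ ms} inc = insert-all (Linked.tail inc) ◅◅ (insX [] (map x ms) m (shuffle-map-x (Linked.tail inc)) (shuffle-map-x inc) ◅ ε)

  mutual
    interval : List ℕ → List ℕ → List Word
    interval ns ms = [] ∷ startA ns ms ++ startX ns ms

    startA : List ℕ → List ℕ → List Word
    startA []       ms = []
    startA (n ∷ ns) ms = map (a n ∷_) (interval ns ms) ++ startA ns ms

    startX : List ℕ → List ℕ → List Word
    startX ns []       = []
    startX ns (m ∷ ms) = map (x m ∷_) (interval ns ms) ++ startX ns ms

  InAlphabet : List ℕ → List ℕ → Letter → Set
  InAlphabet ns ms (a n) = n ∈ ns
  InAlphabet ns ms (x m) = m ∈ ms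

  Within : List ℕ → List ℕ → Word → Set
  Within ns ms = All (InAlphabet ns ms)

  within-weakenA : ∀ {n ns ms v} → Within ns ms v → Within (n ∷ ns) ms v
  within-weakenA = All.map λ { {a k} k∈ → there k∈ ; {x k} k∈ → k∈ }

  within-weakenX : ∀ {m ns ms v} → Within ns ms v → Within ns (m ∷ ms) v
  within-weakenX = All.map λ { {a k} k∈ → k∈ ; {x k} k∈ → there k∈ }

  within-narrowA : ∀ {n ns ms v} → BelowA n v → Within (n ∷ ns) ms v → Within ns ms v
  within-narrowA {v = v} n<v within = All.tabulate (λ l∈v → narrow l∈v (All.lookup within l∈v))
    where
    narrow : ∀ {l} → l ∈ v → InAlphabet _ _ l → InAlphabet _ _ l
    narrow {a k} ak∈v (here refl) = ⊥-elim (ℕₚ.<-irrefl refl (n<v ak∈v))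
    narrow {a k} _    (there k∈)  = k∈
    narrow {x k} _    k∈          = k∈

  within-narrowX : ∀ {m ns ms v} → BelowX m v → Within ns (m ∷ ms) v → Within ns ms v
  within-narrowX {v = v} m<v within = All.tabulate (λ l∈v → narrow l∈v (All.lookup within l∈v))
    where
    narrow : ∀ {l} → l ∈ v → InAlphabet _ _ l → InAlphabet _ _ l
    narrow {x k} xk∈v (here refl) = ⊥-elim (ℕₚ.<-irrefl refl (m<v xk∈v))
    narrow {x k} _    (there k∈)  = k∈
    narrow {a k} _    k∈          = k∈

  mutual
    interval-within : ∀ ns ms → All (Within ns ms) (interval ns ms)
    interval-within ns ms = [] ∷ Allₚ.++⁺ (startA-within ns ms) (startX-within ns ms)

    startA-within : ∀ ns ms → All (Within ns ms) (startA ns ms)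
    startA-within []       ms = []
    startA-within (n ∷ ns) ms = Allₚ.++⁺ (Allₚ.map⁺ (All.map (λ within → here refl ∷ within-weakenA within) (interval-within ns ms)))
                                         (All.map within-weakenA (startA-within ns ms))

    startX-within : ∀ ns ms → All (Within ns ms) (startX ns ms)
    startX-within ns []       = []
    startX-within ns (m ∷ ms) = Allₚ.++⁺ (Allₚ.map⁺ (All.map (λ within → here refl ∷ within-weakenX within) (interval-within ns ms)))
                                         (All.map within-weakenX (startX-within ns ms))

  InInterval : List ℕ → List ℕ → Word → Set
  InInterval ns ms v = map a ns ≤W v × v ≤W map x ms

  a∈map-a : ∀ {k ns} → a k ∈ map a ns → k ∈ ns
  a∈map-a ak∈ with ∈-map⁻ a ak∈
  ... | _ , k∈ , refl = k∈

  x∈map-x : ∀ {k ms} → x k ∈ map x ms → k ∈ ms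
  x∈map-x xk∈ with ∈-map⁻ x xk∈
  ... | _ , k∈ , refl = k∈

  a∉map-x : ∀ {n} ms → a n ∉ map x ms
  a∉map-x ms an∈ with ∈-map⁻ x an∈
  ... | _ , _ , ()

  x∉map-a : ∀ {m} ns → x m ∉ map a ns
  x∉map-a ns xm∈ with ∈-map⁻ a xm∈
  ... | _ , _ , ()

  a∉map-a : ∀ {n ns} → n ∉ ns → a n ∉ map a ns
  a∉map-a n∉ns an∈ = n∉ns (a∈map-a an∈)

  x∉map-x : ∀ {m ms} → m ∉ ms → x m ∉ map x ms
  x∉map-x m∉ms xm∈ = m∉ms (x∈map-x xm∈)

  a∉within : ∀ {n ns ms v} → n ∉ ns → Within ns ms v → a n ∉ v
  a∉within n∉ns within an∈v = n∉ns (All.lookup within an∈v)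

  x∉within : ∀ {m ns ms v} → m ∉ ms → Within ns ms v → x m ∉ v
  x∉within m∉ms within xm∈v = m∉ms (All.lookup within xm∈v)

  in-interval⇒within : ∀ {ns ms v} → InInterval ns ms v → Within ns ms v
  in-interval⇒within {v = v} ((_ , u→v) , (_ , v→w)) = All.tabulate in-alphabet
    where
    in-alphabet : ∀ {l} → l ∈ v → InAlphabet _ _ l
    in-alphabet {a k} ak∈v = a∈map-a (⋖*-a⁻ u→v ak∈v)
    in-alphabet {x k} xk∈v = x∈map-x (⋖*-x⁺ v→w xk∈v)

  mutual
    interval-sound : ∀ {ns ms} → Increasing ns → Increasing ms → All (InInterval ns ms) (interval ns ms)
    interval-sound inc-ns inc-ms =
      ((shuffle-map-a inc-ns , delete-all inc-ns) , (([] , [] , []) , insert-all inc-ms)) ∷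
      Allₚ.++⁺ (startA-sound inc-ns inc-ms) (startX-sound inc-ns inc-ms)

    startA-sound : ∀ {ns ms} → Increasing ns → Increasing ms → All (InInterval ns ms) (startA ns ms)
    startA-sound {[]}     _      _      = []
    startA-sound {n ∷ ns} {ms} inc-ns inc-ms =
      Allₚ.++⁺ (Allₚ.map⁺ (All.map extend (interval-sound inc-tail inc-ms))) (All.map skip (startA-sound inc-tail inc-ms))
      where
      inc-tail = Linked.tail inc-ns
      n<ns : ∀ {s} → Star _⋖_ (map a ns) s → BelowA n s
      n<ns ns→s ak∈s = All.lookup (increasing-head inc-ns) (a∈map-a (⋖*-a⁻ ns→s ak∈s))
      extend : ∀ {v} → InInterval ns ms v → InInterval (n ∷ ns) ms (a n ∷ v)
      extend {v} ((_ , ns→v) , (sh-v , v→ms)) =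
        (shuffle-map-a inc-ns , ⋖*-prefix (a n) ns→v (shuffle-map-a inc-tail) (λ ns→s _ sh-s → shuffle-∷a sh-s (n<ns ns→s))) ,
        (sh-nv , delA [] v n sh-nv sh-v ◅ v→ms)
        where sh-nv = shuffle-∷a sh-v (n<ns ns→v)
      skip : ∀ {v} → InInterval ns ms v → InInterval (n ∷ ns) ms v
      skip ((_ , ns→v) , v≤ms) = (shuffle-map-a inc-ns , delA [] (map a ns) n (shuffle-map-a inc-ns) (shuffle-map-a inc-tail) ◅ ns→v) , v≤ms

    startX-sound : ∀ {ns ms} → Increasing ns → Increasing ms → All (InInterval ns ms) (startX ns ms)
    startX-sound {ms = []}     _      _      = []
    startX-sound {ns} {m ∷ ms} inc-ns inc-ms =
      Allₚ.++⁺ (Allₚ.map⁺ (All.map extend (interval-sound inc-ns inc-tail))) (All.map skip (startX-sound inc-ns inc-tail))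
      where
      inc-tail = Linked.tail inc-ms
      m<ms : ∀ {s} → Star _⋖_ s (map x ms) → BelowX m s
      m<ms s→ms xk∈s = All.lookup (increasing-head inc-ms) (x∈map-x (⋖*-x⁺ s→ms xk∈s))
      extend : ∀ {v} → InInterval ns ms v → InInterval ns (m ∷ ms) (x m ∷ v)
      extend {v} ((sh-ns , ns→v) , (sh-v , v→ms)) =
        (sh-ns , ns→v ◅◅ (insX [] v m sh-v sh-mv ◅ ε)) ,
        (sh-mv , ⋖*-prefix (x m) v→ms sh-v (λ _ s→ms sh-s → shuffle-∷x sh-s (m<ms s→ms)))
        where sh-mv = shuffle-∷x sh-v (m<ms v→ms)
      skip : ∀ {v} → InInterval ns ms v → InInterval ns (m ∷ ms) v
      skip (ns≤v , (sh-v , v→ms)) = ns≤v , (sh-v , v→ms ◅◅ (insX [] (map x ms) m (shuffle-map-x inc-tail) (shuffle-map-x inc-ms) ◅ ε))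

  mutual
    interval-complete : ∀ {ns ms} v → Increasing ns → Increasing ms → IsShuffle v → Within ns ms v → v ∈ interval ns ms
    interval-complete []      _      _      _  _      = here refl
    interval-complete {ns} (a n ∷ v) inc-ns inc-ms sh within =
      there (∈-++⁺ˡ (startA-complete n v inc-ns inc-ms (shuffle-tail sh) (shuffle-belowA sh) within))
    interval-complete {ns} (x m ∷ v) inc-ns inc-ms sh within =
      there (∈-++⁺ʳ (startA ns _) (startX-complete m v inc-ns inc-ms (shuffle-tail sh) (shuffle-belowX sh) within))

    startA-complete : ∀ {ns ms} n v → Increasing ns → Increasing ms → IsShuffle v → BelowA n v →
                      Within ns ms (a n ∷ v) → a n ∷ v ∈ startA ns ms
    startA-complete {n₀ ∷ ns} {ms} n v inc-ns inc-ms sh n<v (n∈ ∷ within) with n∈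
    ... | here refl = ∈-++⁺ˡ (∈-map⁺ (a n ∷_) (interval-complete v (Linked.tail inc-ns) inc-ms sh (within-narrowA n<v within)))
    ... | there n∈ns = ∈-++⁺ʳ (map (a n₀ ∷_) (interval ns ms))
                         (startA-complete n v (Linked.tail inc-ns) inc-ms sh n<v (n∈ns ∷ within-narrowA n₀<v within))
      where
      n₀<v : BelowA n₀ v
      n₀<v ak∈v = ℕₚ.<-trans (All.lookup (increasing-head inc-ns) n∈ns) (n<v ak∈v)

    startX-complete : ∀ {ns ms} m v → Increasing ns → Increasing ms → IsShuffle v → BelowX m v →
                      Within ns ms (x m ∷ v) → x m ∷ v ∈ startX ns ms
    startX-complete {ns} {m₀ ∷ ms} m v inc-ns inc-ms sh m<v (m∈ ∷ within) with m∈
    ... | here refl = ∈-++⁺ˡ (∈-map⁺ (x m ∷_) (interval-complete v inc-ns (Linked.tail inc-ms) sh (within-narrowX m<v within)))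
    ... | there m∈ms = ∈-++⁺ʳ (map (x m₀ ∷_) (interval ns ms))
                         (startX-complete m v inc-ns (Linked.tail inc-ms) sh m<v (m∈ms ∷ within-narrowX m₀<v within))
      where
      m₀<v : BelowX m₀ v
      m₀<v xk∈v = ℕₚ.<-trans (All.lookup (increasing-head inc-ms) m∈ms) (m<v xk∈v)

  data StartsWithA (ns : List ℕ) : Word → Set where
    startsWithA : ∀ {k t} → k ∈ ns → StartsWithA ns (a k ∷ t)

  data StartsWithX (ms : List ℕ) : Word → Set where
    startsWithX : ∀ {k t} → k ∈ ms → StartsWithX ms (x k ∷ t)

  startA-heads : ∀ ns ms → All (StartsWithA ns) (startA ns ms)
  startA-heads []       ms = []
  startA-heads (n ∷ ns) ms = Allₚ.++⁺ (Allₚ.map⁺ (All.universal (λ _ → startsWithA (here refl)) _))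
                                      (All.map (λ { (startsWithA k∈) → startsWithA (there k∈) }) (startA-heads ns ms))

  startX-heads : ∀ ns ms → All (StartsWithX ms) (startX ns ms)
  startX-heads ns []       = []
  startX-heads ns (m ∷ ms) = Allₚ.++⁺ (Allₚ.map⁺ (All.universal (λ _ → startsWithX (here refl)) _))
                                      (All.map (λ { (startsWithX k∈) → startsWithX (there k∈) }) (startX-heads ns ms))

  mutual
    interval-unique : ∀ {ns ms} → Unique ns → Unique ms → Unique (interval ns ms)
    interval-unique {ns} {ms} uns ums =
      Allₚ.++⁺ (All.map (λ { (startsWithA _) () }) (startA-heads ns ms))
               (All.map (λ { (startsWithX _) () }) (startX-heads ns ms)) ∷
      Uniqueₚ.++⁺ (startA-unique uns ums) (startX-unique uns ums) disjoint
      where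
      disjoint : ∀ {v} → ¬ (v ∈ startA ns ms × v ∈ startX ns ms)
      disjoint (v∈A , v∈X) with All.lookup (startA-heads ns ms) v∈A | All.lookup (startX-heads ns ms) v∈X
      ... | startsWithA _ | ()

    startA-unique : ∀ {ns ms} → Unique ns → Unique ms → Unique (startA ns ms)
    startA-unique {[]}     _              _   = []
    startA-unique {n ∷ ns} {ms} (n∉ns ∷ uns) ums =
      Uniqueₚ.++⁺ (Uniqueₚ.map⁺ (λ { refl → refl }) (interval-unique uns ums)) (startA-unique uns ums) disjoint
      where
      disjoint : ∀ {v} → ¬ (v ∈ map (a n ∷_) (interval ns ms) × v ∈ startA ns ms)
      disjoint (v∈first , v∈rest) with ∈-map⁻ (a n ∷_) v∈first | All.lookup (startA-heads ns ms) v∈rest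
      ... | _ , _ , refl | startsWithA n∈ns = Allₚ.All¬⇒¬Any n∉ns n∈ns

    startX-unique : ∀ {ns ms} → Unique ns → Unique ms → Unique (startX ns ms)
    startX-unique {ms = []}     _   _              = []
    startX-unique {ns} {m ∷ ms} uns (m∉ms ∷ ums) =
      Uniqueₚ.++⁺ (Uniqueₚ.map⁺ (λ { refl → refl }) (interval-unique uns ums)) (startX-unique uns ums) disjoint
      where
      disjoint : ∀ {v} → ¬ (v ∈ map (x m ∷_) (interval ns ms) × v ∈ startX ns ms)
      disjoint (v∈first , v∈rest) with ∈-map⁻ (x m ∷_) v∈first | All.lookup (startX-heads ns ms) v∈rest
      ... | _ , _ , refl | startsWithX m∈ms = Allₚ.All¬⇒¬Any m∉ms m∈ms

module Segments where

  open ≡ using (refl)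
  open DecMembership _≟L_ using (_∈?_)

  bumpHead : ℕ → List ℕ → List ℕ
  bumpHead r []       = r ∷ []
  bumpHead r (k ∷ ks) = r ℕ.+ k ∷ ks

  bumpHead-bumpHead : ∀ r ks → bumpHead r (bumpHead 1 ks) ≡ bumpHead (suc r) ks
  bumpHead-bumpHead r []       = ≡.cong (_∷ []) (ℕₚ.+-comm r 1)
  bumpHead-bumpHead r (k ∷ ks) = ≡.cong (_∷ ks) (ℕₚ.+-suc r k)

  segs-∈ : ∀ {l} u w → l ∈ w → segs (l ∷ u) w ≡ 0 ∷ segs u w
  segs-∈ {l} u w l∈w with l ∈? w
  ... | yes _   = refl
  ... | no  l∉w = ⊥-elim (l∉w l∈w)

  segs-∉ : ∀ {l} u w → l ∉ w → segs (l ∷ u) w ≡ bumpHead 1 (segs u w)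
  segs-∉ {l} u w l∉w with l ∈? w | segs u w
  ... | yes l∈w | _      = ⊥-elim (l∉w l∈w)
  ... | no  _   | []     = refl
  ... | no  _   | k ∷ ks = refl

  segs-fresh : ∀ {l} u w → l ∉ u → segs u (l ∷ w) ≡ segs u w
  segs-fresh     []       w _  = refl
  segs-fresh {l} (l′ ∷ u) w l∉ = by-cases (l′ ∈? w)
    where
    IH : segs u (l ∷ w) ≡ segs u w
    IH = segs-fresh u w (λ l∈u → l∉ (there l∈u))
    by-cases : Dec (l′ ∈ w) → segs (l′ ∷ u) (l ∷ w) ≡ segs (l′ ∷ u) w
    by-cases (yes l′∈w) =
      ≡.trans (segs-∈ u (l ∷ w) (there l′∈w)) (≡.trans (≡.cong (0 ∷_) IH) (≡.sym (segs-∈ u w l′∈w)))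
    by-cases (no  l′∉w) =
      ≡.trans (segs-∉ u (l ∷ w) l′∉lw) (≡.trans (≡.cong (bumpHead 1) IH) (≡.sym (segs-∉ u w l′∉w)))
      where
      l′∉lw : l′ ∉ l ∷ w
      l′∉lw (here refl)    = l∉ (here refl)
      l′∉lw (there l′∈w) = l′∉w l′∈w

  segs-[] : ∀ u → segs u [] ≡ length u ∷ []
  segs-[] []      = refl
  segs-[] (l ∷ u) = ≡.trans (segs-∉ u [] (λ ())) (≡.cong (bumpHead 1) (segs-[] u))

  bumpHead-0-bumpHead : ∀ r ks → bumpHead 0 (bumpHead r ks) ≡ bumpHead r ks
  bumpHead-0-bumpHead r []       = refl
  bumpHead-0-bumpHead r (k ∷ ks) = refl

  bumpHead-0-segs : ∀ u w → bumpHead 0 (segs u w) ≡ segs u w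
  bumpHead-0-segs []      w = refl
  bumpHead-0-segs (l ∷ u) w = by-cases (l ∈? w)
    where
    by-cases : Dec (l ∈ w) → bumpHead 0 (segs (l ∷ u) w) ≡ segs (l ∷ u) w
    by-cases (yes l∈w) = ≡.trans (≡.cong (bumpHead 0) (segs-∈ u w l∈w)) (≡.sym (segs-∈ u w l∈w))
    by-cases (no  l∉w) = ≡.trans (≡.cong (bumpHead 0) (segs-∉ u w l∉w))
                                 (≡.trans (bumpHead-0-bumpHead 1 (segs u w)) (≡.sym (segs-∉ u w l∉w)))

module ListSums {c ℓ : Level} (R : CommutativeRing c ℓ) where

  open CommutativeRing R
  open import Data.List.Relation.Binary.Permutation.Propositional using (_↭_; ↭⇒↭ₛ′)
  import Data.List.Relation.Binary.Permutation.Propositional.Properties as ↭ₚ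
  open import Data.List.Relation.Binary.Permutation.Setoid.Properties setoid using (foldr-commMonoid)

  module _ {A : Set} (h : A → Carrier) where

    sumList-++ : ∀ L₁ L₂ → sumList R (map h (L₁ ++ L₂)) ≈ sumList R (map h L₁) + sumList R (map h L₂)
    sumList-++ []       L₂ = sym (+-identityˡ _)
    sumList-++ (v ∷ L₁) L₂ = trans (+-congˡ (sumList-++ L₁ L₂)) (sym (+-assoc _ _ _))

    sumList-*ˡ : ∀ s L → sumList R (map (λ v → s * h v) L) ≈ s * sumList R (map h L)
    sumList-*ˡ s []      = sym (zeroʳ s)
    sumList-*ˡ s (v ∷ L) = trans (+-congˡ (sumList-*ˡ s L)) (sym (distribˡ s _ _))

    sumList-↭ : ∀ {L L′} → L ↭ L′ → sumList R (map h L) ≈ sumList R (map h L′)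
    sumList-↭ L↭L′ = foldr-commMonoid +-isCommutativeMonoid (↭⇒↭ₛ′ isEquivalence (↭ₚ.map⁺ h L↭L′))

  sumList-cong : ∀ {A : Set} {h h′ : A → Carrier} {L} → All (λ v → h v ≈ h′ v) L → sumList R (map h L) ≈ sumList R (map h′ L)
  sumList-cong []             = refl
  sumList-cong (h≈h′ ∷ rest) = +-cong h≈h′ (sumList-cong rest)

module IntervalSum {c ℓ : Level} (R : CommutativeRing c ℓ) (f g : ℕ → ℕ → CommutativeRing.Carrier R) where

  open ShuffleWords
  open CommutativeRing R
  open import Relation.Binary.Reasoning.Setoid setoid
  open Segments
  open ListSums R
  open ConvolutionSeries R f g using (conv; convA; convX)

  weight : (ℕ → ℕ → Carrier) → ℕ → ℕ → Word → Word → Carrier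
  weight coef r p u v = foldr _*_ 1# (zipWith coef (bumpHead r (segs u v)) (bumpHead p (segs v u)))

  weight-0-0 : ∀ coef u v → weight coef 0 0 u v ≡ canonicalValue R coef u v
  weight-0-0 coef u v = ≡.cong₂ (λ s t → foldr _*_ 1# (zipWith coef s t)) (bumpHead-0-segs u v) (bumpHead-0-segs v u)

  weight-∷ˡ : ∀ coef r p {l} u v → l ∉ v → weight coef r p (l ∷ u) v ≡ weight coef (suc r) p u v
  weight-∷ˡ coef r p u v l∉v = ≡.cong₂ (λ s t → foldr _*_ 1# (zipWith coef s t))
    (≡.trans (≡.cong (bumpHead r) (segs-∉ u v l∉v)) (bumpHead-bumpHead r (segs u v)))
    (≡.cong (bumpHead p) (segs-fresh v u l∉v))

  weight-∷ʳ : ∀ coef r p {l} u v → l ∉ u → weight coef r p u (l ∷ v) ≡ weight coef r (suc p) u v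
  weight-∷ʳ coef r p u v l∉u = ≡.cong₂ (λ s t → foldr _*_ 1# (zipWith coef s t))
    (≡.cong (bumpHead r) (segs-fresh u v l∉u))
    (≡.trans (≡.cong (bumpHead p) (segs-∉ v u l∉u)) (bumpHead-bumpHead p (segs v u)))

  weight-∷-common : ∀ coef r p {l} u v → l ∉ u → l ∉ v → weight coef r p (l ∷ u) (l ∷ v) ≈ coef r p * weight coef 0 0 u v
  weight-∷-common coef r p {l} u v l∉u l∉v = begin
    weight coef r p (l ∷ u) (l ∷ v)
      ≡⟨ ≡.cong₂ (λ s t → foldr _*_ 1# (zipWith coef (bumpHead r s) (bumpHead p t)))
                 (≡.trans (segs-∈ u (l ∷ v) (here ≡.refl)) (≡.cong (0 ∷_) (segs-fresh u v l∉u)))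
                 (≡.trans (segs-∈ v (l ∷ u) (here ≡.refl)) (≡.cong (0 ∷_) (segs-fresh v u l∉v))) ⟩
    coef (r ℕ.+ 0) (p ℕ.+ 0) * foldr _*_ 1# (zipWith coef (segs u v) (segs v u))
      ≡⟨ ≡.cong₂ (λ i j → coef i j * foldr _*_ 1# (zipWith coef (segs u v) (segs v u))) (ℕₚ.+-identityʳ r) (ℕₚ.+-identityʳ p) ⟩
    coef r p * foldr _*_ 1# (zipWith coef (segs u v) (segs v u))
      ≡⟨ ≡.cong (coef r p *_) (≡.sym (≡.cong₂ (λ s t → foldr _*_ 1# (zipWith coef s t)) (bumpHead-0-segs u v) (bumpHead-0-segs v u))) ⟩
    coef r p * weight coef 0 0 u v   ∎

  weight-[]ʳ : ∀ coef r p u → weight coef r p u [] ≈ coef (r ℕ.+ length u) p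
  weight-[]ʳ coef r p u = begin
    weight coef r p u []                   ≡⟨ ≡.cong (λ s → foldr _*_ 1# (zipWith coef (bumpHead r s) (p ℕ.+ 0 ∷ []))) (segs-[] u) ⟩
    coef (r ℕ.+ length u) (p ℕ.+ 0) * 1#   ≈⟨ *-identityʳ _ ⟩
    coef (r ℕ.+ length u) (p ℕ.+ 0)        ≡⟨ ≡.cong (coef (r ℕ.+ length u)) (ℕₚ.+-identityʳ p) ⟩
    coef (r ℕ.+ length u) p                ∎

  weight-[]ˡ : ∀ coef r p w → weight coef r p [] w ≈ coef r (p ℕ.+ length w)
  weight-[]ˡ coef r p w = begin
    weight coef r p [] w                   ≡⟨ ≡.cong (λ s → foldr _*_ 1# (zipWith coef (r ℕ.+ 0 ∷ []) (bumpHead p s))) (segs-[] w) ⟩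
    coef (r ℕ.+ 0) (p ℕ.+ length w) * 1#   ≈⟨ *-identityʳ _ ⟩
    coef (r ℕ.+ 0) (p ℕ.+ length w)        ≡⟨ ≡.cong (λ i → coef i (p ℕ.+ length w)) (ℕₚ.+-identityʳ r) ⟩
    coef r (p ℕ.+ length w)                ∎

  summand : ℕ → ℕ → ℕ → ℕ → List ℕ → List ℕ → Word → Carrier
  summand r p q s ns ms v = weight f r p (map a ns) v * weight g q s v (map x ms)

  summand-[] : ∀ p q ns ms → summand 0 p q 0 ns ms [] ≈ f (length ns) p * g q (length ms)
  summand-[] p q ns ms = *-cong (trans (weight-[]ʳ f 0 p (map a ns)) (reflexive (≡.cong (λ i → f i p) (Listₚ.length-map a ns))))
                                (trans (weight-[]ˡ g q 0 (map x ms)) (reflexive (≡.cong (g q) (Listₚ.length-map x ms))))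

  summand-a∷ : ∀ {n ns ms} r p q → n ∉ ns → ∀ {v} → Within ns ms v →
    summand r p q 0 (n ∷ ns) ms (a n ∷ v) ≈ f r p * summand 0 0 (suc q) 0 ns ms v
  summand-a∷ {n} {ns} {ms} r p q n∉ns {v} within = begin
    weight f r p (a n ∷ map a ns) (a n ∷ v) * weight g q 0 (a n ∷ v) (map x ms)
      ≈⟨ *-cong (weight-∷-common f r p (map a ns) v (a∉map-a n∉ns) (a∉within n∉ns within))
                (reflexive (weight-∷ˡ g q 0 v (map x ms) (a∉map-x ms))) ⟩
    f r p * weight f 0 0 (map a ns) v * weight g (suc q) 0 v (map x ms)
      ≈⟨ *-assoc _ _ _ ⟩
    f r p * summand 0 0 (suc q) 0 ns ms v   ∎

  summand-skipA : ∀ {n ns ms} r p q → n ∉ ns → ∀ {v} → Within ns ms v →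
    summand r p q 0 (n ∷ ns) ms v ≈ summand (suc r) p q 0 ns ms v
  summand-skipA {n} {ns} {ms} r p q n∉ns {v} within =
    reflexive (≡.cong (_* weight g q 0 v (map x ms)) (weight-∷ˡ f r p (map a ns) v (a∉within n∉ns within)))

  summand-x∷ : ∀ {m ns ms} p q s → m ∉ ms → ∀ {v} → Within ns ms v →
    summand 0 p q s ns (m ∷ ms) (x m ∷ v) ≈ g q s * summand 0 (suc p) 0 0 ns ms v
  summand-x∷ {m} {ns} {ms} p q s m∉ms {v} within = begin
    weight f 0 p (map a ns) (x m ∷ v) * weight g q s (x m ∷ v) (x m ∷ map x ms)
      ≈⟨ *-cong (reflexive (weight-∷ʳ f 0 p (map a ns) v (x∉map-a ns)))
                (weight-∷-common g q s v (map x ms) (x∉within m∉ms within) (x∉map-x m∉ms)) ⟩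
    weight f 0 (suc p) (map a ns) v * (g q s * weight g 0 0 v (map x ms))
      ≈⟨ x∙yz≈y∙xz _ _ _ ⟩
    g q s * summand 0 (suc p) 0 0 ns ms v   ∎
    where open import Algebra.Properties.CommutativeSemigroup *-commutativeSemigroup using (x∙yz≈y∙xz)

  summand-skipX : ∀ {m ns ms} p q s → m ∉ ms → ∀ {v} → Within ns ms v →
    summand 0 p q s ns (m ∷ ms) v ≈ summand 0 p q (suc s) ns ms v
  summand-skipX {m} {ns} {ms} p q s m∉ms {v} within =
    reflexive (≡.cong (weight f 0 p (map a ns) v *_) (weight-∷ʳ g q s v (map x ms) (x∉within m∉ms within)))

  mutual
    sum-interval : ∀ {ns ms} → Unique ns → Unique ms → ∀ p q →
      sumList R (map (summand 0 p q 0 ns ms) (interval ns ms)) ≈ conv (length ns) (length ms) p q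
    sum-interval {ns} {ms} uns ums p q = begin
      summand 0 p q 0 ns ms [] + sumList R (map h (startA ns ms ++ startX ns ms))
        ≈⟨ +-cong (summand-[] p q ns ms) (sumList-++ h (startA ns ms) (startX ns ms)) ⟩
      f (length ns) p * g q (length ms) + (sumList R (map h (startA ns ms)) + sumList R (map h (startX ns ms)))
        ≈⟨ +-congˡ (+-cong (sum-startA uns ums p q 0) (sum-startX uns ums p q 0)) ⟩
      f (length ns) p * g q (length ms) + (convA (length ns) (length ms) p q 0 + convX (length ns) (length ms) p q 0)
        ≈⟨ sym (+-assoc _ _ _) ⟩
      conv (length ns) (length ms) p q   ∎
      where h = summand 0 p q 0 ns ms

    sum-startA : ∀ {ns ms} → Unique ns → Unique ms → ∀ p q r →
      sumList R (map (summand r p q 0 ns ms) (startA ns ms)) ≈ convA (length ns) (length ms) p q r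
    sum-startA {[]}     _            _   p q r = refl
    sum-startA {n ∷ ns} {ms} (n≢ns ∷ uns) ums p q r = begin
      sumList R (map h (map (a n ∷_) (interval ns ms) ++ startA ns ms))
        ≈⟨ sumList-++ h (map (a n ∷_) (interval ns ms)) (startA ns ms) ⟩
      sumList R (map h (map (a n ∷_) (interval ns ms))) + sumList R (map h (startA ns ms))
        ≡⟨ ≡.cong (λ L → sumList R L + sumList R (map h (startA ns ms))) (≡.sym (Listₚ.map-∘ (interval ns ms))) ⟩
      sumList R (map (λ v → h (a n ∷ v)) (interval ns ms)) + sumList R (map h (startA ns ms))
        ≈⟨ +-cong (sumList-cong (All.map (summand-a∷ r p q n∉ns) (interval-within ns ms)))
                  (sumList-cong (All.map (summand-skipA r p q n∉ns) (startA-within ns ms))) ⟩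
      sumList R (map (λ v → f r p * summand 0 0 (suc q) 0 ns ms v) (interval ns ms)) + sumList R (map (summand (suc r) p q 0 ns ms) (startA ns ms))
        ≈⟨ +-cong (trans (sumList-*ˡ (summand 0 0 (suc q) 0 ns ms) (f r p) (interval ns ms)) (*-congˡ (sum-interval uns ums 0 (suc q))))
                  (sum-startA uns ums p q (suc r)) ⟩
      convA (length (n ∷ ns)) (length ms) p q r   ∎
      where
      h = summand r p q 0 (n ∷ ns) ms
      n∉ns = Allₚ.All¬⇒¬Any n≢ns

    sum-startX : ∀ {ns ms} → Unique ns → Unique ms → ∀ p q s →
      sumList R (map (summand 0 p q s ns ms) (startX ns ms)) ≈ convX (length ns) (length ms) p q s
    sum-startX {ms = []}     _   _            p q s = refl
    sum-startX {ns} {m ∷ ms} uns (m≢ms ∷ ums) p q s = begin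
      sumList R (map h (map (x m ∷_) (interval ns ms) ++ startX ns ms))
        ≈⟨ sumList-++ h (map (x m ∷_) (interval ns ms)) (startX ns ms) ⟩
      sumList R (map h (map (x m ∷_) (interval ns ms))) + sumList R (map h (startX ns ms))
        ≡⟨ ≡.cong (λ L → sumList R L + sumList R (map h (startX ns ms))) (≡.sym (Listₚ.map-∘ (interval ns ms))) ⟩
      sumList R (map (λ v → h (x m ∷ v)) (interval ns ms)) + sumList R (map h (startX ns ms))
        ≈⟨ +-cong (sumList-cong (All.map (summand-x∷ p q s m∉ms) (interval-within ns ms)))
                  (sumList-cong (All.map (summand-skipX p q s m∉ms) (startX-within ns ms))) ⟩
      sumList R (map (λ v → g q s * summand 0 (suc p) 0 0 ns ms v) (interval ns ms)) + sumList R (map (summand 0 p q (suc s) ns ms) (startX ns ms))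
        ≈⟨ +-cong (trans (sumList-*ˡ (summand 0 (suc p) 0 0 ns ms) (g q s) (interval ns ms)) (*-congˡ (sum-interval uns ums (suc p) 0)))
                  (sum-startX uns ums p q (suc s)) ⟩
      convX (length ns) (length (m ∷ ms)) p q s   ∎
      where
      h = summand 0 p q s ns (m ∷ ms)
      m∉ms = Allₚ.All¬⇒¬Any m≢ms

module ConvolutionCoefficient {c ℓ : Level} (R : CommutativeRing c ℓ) where

  open ShuffleWords
  open CommutativeRing R
  open import Relation.Binary.Reasoning.Setoid setoid
  open import Data.List.Relation.Binary.Permutation.Propositional using (_↭_)
  open ListSums R

  indices : ℕ → List ℕ
  indices n = applyUpTo suc n

  indices-increasing : ∀ n → Increasing (indices n)
  indices-increasing n = applyUpTo⁺₂ suc n (λ _ → ℕₚ.≤-refl)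

  aWord≡map-a : ∀ i → aWord i ≡ map a (indices i)
  aWord≡map-a i = ≡.trans (Listₚ.map-applyUpTo (λ n → n) (λ n → a (suc n)) i) (≡.sym (Listₚ.map-applyUpTo suc a i))

  xWord≡map-x : ∀ j → xWord j ≡ map x (indices j)
  xWord≡map-x j = ≡.trans (Listₚ.map-applyUpTo (λ n → n) (λ n → x (suc n)) j) (≡.sym (Listₚ.map-applyUpTo suc x j))

  elems↭interval : ∀ {i j} (E : IntervalEnum R (aWord i) (xWord j)) → elems E ↭ interval (indices i) (indices j)
  elems↭interval {i} {j} E = ∼bag⇒↭ (unique∧set⇒bag (unique E) interval-unique′ (mk⇔ to from))
    where
    inc-ns = indices-increasing i
    inc-ms = indices-increasing j
    interval-unique′ = interval-unique (increasing-unique inc-ns) (increasing-unique inc-ms)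
    to : ∀ {v} → v ∈ elems E → v ∈ interval (indices i) (indices j)
    to {v} v∈E with sound E v v∈E
    ... | u≤v , v≤w = interval-complete v inc-ns inc-ms (proj₁ v≤w′) (in-interval⇒within (u≤v′ , v≤w′))
      where
      u≤v′ = ≡.subst (_≤W v) (aWord≡map-a i) u≤v
      v≤w′ = ≡.subst (v ≤W_) (xWord≡map-x j) v≤w
    from : ∀ {v} → v ∈ interval (indices i) (indices j) → v ∈ elems E
    from {v} v∈I with All.lookup (interval-sound inc-ns inc-ms) v∈I
    ... | u≤v , v≤w = complete E v (≡.subst (_≤W v) (≡.sym (aWord≡map-a i)) u≤v) (≡.subst (v ≤W_) (≡.sym (xWord≡map-x j)) v≤w)

  convolution≈conv : ∀ (f g : MultFun R) i j (E : IntervalEnum R (aWord i) (xWord j)) →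
    convolution R f g (aWord i) (xWord j) E ≈ ConvolutionSeries.conv R (coef f) (coef g) i j 0 0
  convolution≈conv f g i j E = begin
    sumList R (map (λ v → fun f (aWord i) v * fun g v (xWord j)) (elems E))
      ≈⟨ sumList-cong (All.tabulate (λ {v} v∈E → canonical v (sound E v v∈E))) ⟩
    sumList R (map (summand 0 0 0 0 ns ms) (elems E))
      ≈⟨ sumList-↭ (summand 0 0 0 0 ns ms) (elems↭interval E) ⟩
    sumList R (map (summand 0 0 0 0 ns ms) (interval ns ms))
      ≈⟨ sum-interval (increasing-unique (indices-increasing i)) (increasing-unique (indices-increasing j)) 0 0 ⟩
    conv (length ns) (length ms) 0 0
      ≡⟨ ≡.cong₂ (λ I J → conv I J 0 0) (Listₚ.length-applyUpTo suc i) (Listₚ.length-applyUpTo suc j) ⟩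
    conv i j 0 0   ∎
    where
    open IntervalSum R (coef f) (coef g)
    open ConvolutionSeries R (coef f) (coef g) using (conv)
    ns = indices i
    ms = indices j
    canonical : ∀ v → aWord i ≤W v × v ≤W xWord j → fun f (aWord i) v * fun g v (xWord j) ≈ summand 0 0 0 0 ns ms v
    canonical v (u≤v , v≤w) = *-cong
      (trans (mult f (aWord i) v u≤v) (reflexive (≡.trans (≡.cong (λ u → canonicalValue R (coef f) u v) (aWord≡map-a i))
                                                         (≡.sym (weight-0-0 (coef f) (map a ns) v)))))
      (trans (mult g v (xWord j) v≤w) (reflexive (≡.trans (≡.cong (canonicalValue R (coef g) v) (xWord≡map-x j))
                                                         (≡.sym (weight-0-0 (coef g) v (map x ms))))))

theorem5p2 : {c ℓ : Level} (R : CommutativeRing c ℓ) →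
    (f g : MultFun R) →
    (E : ∀ i j → IntervalEnum R (aWord i) (xWord j)) →
    let F = genFun R f
        G = genFun R g
        FG = convSeries R f g E
        F0 = atY0 R F
        G0 = atX0 R G
        Ft = compose R F (X R) (mulS R G0 (Y R))
        Gt = compose R G (mulS R F0 (X R)) (Y R)
    in (P Q S T : Series R) →
       IsInverseOf R P FG →
       IsInverseOf R Q (mulS R Ft G0) →
       IsInverseOf R S (mulS R F0 Gt) →
       IsInverseOf R T (mulS R F0 G0) →
       _≈S_ R P (subS R (addS R Q S) T)
theorem5p2 R f g E P Q S T P-inverse Q-inverse S-inverse T-inverse =
  ReciprocalIdentity.reciprocal-identity R₂ {F₀} {G₀} {F̃} {G̃} {Φ 0 0} {P} {Q} {S} {T}
    conv-elimination-identity
    (R₂.trans (R₂.*-congʳ {P} Φ₀₀≈FG) (inverse⇒*≈1 (convSeries R f g E) P P-inverse))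
    (R₂.trans (R₂.*-congʳ {Q} (R₂.sym (mulS≈* F̃ G₀))) (inverse⇒*≈1 (mulS R F̃ G₀) Q Q-inverse))
    (R₂.trans (R₂.*-congʳ {S} (R₂.sym (mulS≈* F₀ G̃))) (inverse⇒*≈1 (mulS R F₀ G̃) S S-inverse))
    (R₂.trans (R₂.*-congʳ {T} (R₂.sym (mulS≈* F₀ G₀))) (inverse⇒*≈1 (mulS R F₀ G₀) T T-inverse))
  where
  open BivariateSeries R
  open ConvolutionSeries R (coef f) (coef g)
  Φ₀₀≈FG : Φ 0 0 ≈₂ convSeries R f g E
  Φ₀₀≈FG i j = CommutativeRing.sym R (ConvolutionCoefficient.convolution≈conv R f g i j (E i j))
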